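{- A plane belonging to the $K$-orbit $\Sigma_3$ has point-orbit distribution $[2,(3q-1)/2,(q-1)/2,q^2-q]$.
   Context: $q$ is odd. Points of $\mathrm{PG}(5,q)$ are represented by symmetric $3\times3$ matrices over $\mathbb{F}_q$ (up to scalars), with rank equal to the matrix rank; rank-1 points form the quadric Veronesean $\mathcal{V}(\mathbb{F}_q)$. $K=\mathrm{PGL}(3,q)$ acts via $M\mapsto AMA^T$. Each rank-2 point $z$ lies in the plane of a unique conic $\mathcal{C}_z\subset\mathcal{V}(\mathbb{F}_q)$; $z$ is exterior ($\mathcal{P}_{2,e}$) if it lies on a tangent to $\mathcal{C}_z$ and interior ($\mathcal{P}_{2,i}$) otherwise. The point-orbit distribution is $[n_1,n_2,n_3,n_4]$ = numbers of points of rank 1, of $\mathcal{P}_{2,e}$, of $\mathcal{P}_{2,i}$, of rank 3. $\Sigma_3$ is the $K$-orbit of the plane $\{\begin{pmatrix}\alpha&0&\gamma\\ 0&\beta&0\\ \gamma&0&0\end{pmatrix}\}$, $(\alpha,\beta,\gamma)\neq 0$. -}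

module Defs where

open import Level using (0ℓ)
open import Data.Nat using (ℕ)
open import Data.Fin using (Fin; zero; suc)
open import Data.List using (List; length)
open import Data.List.Membership.Propositional using (_∈_)
open import Data.List.Relation.Unary.All using (All)
open import Data.List.Relation.Unary.Any using (Any)
open import Data.List.Relation.Unary.AllPairs using (AllPairs)
open import Data.List.Relation.Unary.Unique.Propositional using (Unique)
open import Data.Product using (Σ; ∃; _×_; _,_)
open import Data.Empty using (⊥)
open import Relation.Nullary using (¬_; Dec)
open import Relation.Binary.PropositionalEquality using (_≡_; _≢_)
open import Algebra.Structures using (IsCommutativeRing)

record FiniteField : Set₁ where
  infixl 6 _+_
  infixl 7 _*_
  field
    Carrier : Set
    _+_ _*_ : Carrier → Carrier → Carrier
    -_      : Carrier → Carrier
    0# 1#   : Carrier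
    isCommutativeRing : IsCommutativeRing _≡_ _+_ _*_ -_ 0# 1#
    0≢1     : 0# ≢ 1#
    inverse : ∀ x → x ≢ 0# → Σ Carrier λ y → x * y ≡ 1#
    _≟_     : (x y : Carrier) → Dec (x ≡ y)
    elements : List Carrier
    elements-unique   : Unique elements
    elements-complete : ∀ x → x ∈ elements

  order : ℕ
  order = length elements

-- Geometry of PG(5,q) as symmetric 3×3 matrices, for a fixed field.

module Geometry (F : FiniteField) where
  open FiniteField F

  Vec3 : Set
  Vec3 = Fin 3 → Carrier

  Mat : Set
  Mat = Fin 3 → Fin 3 → Carrier

  sum3 : (Fin 3 → Carrier) → Carrier
  sum3 f = f zero + f (suc zero) + f (suc (suc zero))

  _·_ : Mat → Mat → Mat
  (A · B) i j = sum3 λ k → A i k * B k j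

  transpose : Mat → Mat
  transpose A i j = A j i

  identity : Mat
  identity zero    zero             = 1#
  identity (suc zero) (suc zero)    = 1#
  identity (suc (suc zero)) (suc (suc zero)) = 1#
  identity _ _ = 0#

  _≈_ : Mat → Mat → Set
  M ≈ N = ∀ i j → M i j ≡ N i j

  Invertible : Mat → Set
  Invertible A = Σ Mat λ B → (A · B) ≈ identity × (B · A) ≈ identity

  act : Mat → Mat → Mat
  act A M = (A · M) · transpose A

  Σ3-matrix : Carrier → Carrier → Carrier → Mat
  Σ3-matrix α β γ zero zero = α
  Σ3-matrix α β γ zero (suc (suc zero)) = γ
  Σ3-matrix α β γ (suc zero) (suc zero) = β
  Σ3-matrix α β γ (suc (suc zero)) zero = γ
  Σ3-matrix α β γ _ _ = 0#

  -- M is a vector of the (3-dim subspace underlying the) plane A·π·Aᵀ,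
  -- π the representative plane of Σ₃
  InPlane : Mat → Mat → Set
  InPlane A M = Σ Carrier λ α → Σ Carrier λ β → Σ Carrier λ γ →
                  M ≈ act A (Σ3-matrix α β γ)

  IsZero : Mat → Set
  IsZero M = ∀ i j → M i j ≡ 0#

  -- projective equality (same point of PG(5,q))
  _∼_ : Mat → Mat → Set
  M ∼ N = Σ Carrier λ λ' → λ' ≢ 0# × (∀ i j → M i j ≡ λ' * N i j)

  minor2 : Mat → Fin 3 → Fin 3 → Fin 3 → Fin 3 → Carrier
  minor2 M i j k l = M i k * M j l + - (M i l * M j k)

  det : Mat → Carrier
  det M = sum3 λ k → M zero k * cof k
    where
    cof : Fin 3 → Carrier
    cof zero             = minor2 M (suc zero) (suc (suc zero)) (suc zero) (suc (suc zero))
    cof (suc zero)       = - minor2 M (suc zero) (suc (suc zero)) zero (suc (suc zero))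
    cof (suc (suc zero)) = minor2 M (suc zero) (suc (suc zero)) zero (suc zero)

  Rank1 : Mat → Set
  Rank1 M = ¬ IsZero M × (∀ i j k l → minor2 M i j k l ≡ 0#)

  Rank2 : Mat → Set
  Rank2 M = ¬ (∀ i j k l → minor2 M i j k l ≡ 0#) × det M ≡ 0#

  Rank3 : Mat → Set
  Rank3 M = det M ≢ 0#

  lin : Carrier → Vec3 → Carrier → Vec3 → Vec3
  lin a u b w i = a * u i + b * w i

  IsZeroV : Vec3 → Set
  IsZeroV v = ∀ i → v i ≡ 0#

  outer : Vec3 → Mat
  outer v i j = v i * v j

  sym : Vec3 → Vec3 → Mat
  sym u w i j = u i * w j + w i * u j

  _⊕_ : Mat → Mat → Mat
  (M ⊕ N) i j = M i j + N i j

  _⊙_ : Carrier → Mat → Mat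
  (a ⊙ M) i j = a * M i j

  LinIndep : Vec3 → Vec3 → Set
  LinIndep u w = ∀ a b → IsZeroV (lin a u b w) → a ≡ 0# × b ≡ 0#

  ProportionalV : Vec3 → Vec3 → Set
  ProportionalV p v = Σ Carrier λ λ' → ∀ i → p i ≡ λ' * v i

  -- The conic C of V(F_q) defined by the line ⟨u,w⟩ of PG(2,q) is
  -- { pᵀp : p ∈ ⟨u,w⟩ }, its plane is ⟨uuᵀ, wwᵀ, uwᵀ+wuᵀ⟩.
  -- z is exterior iff z has rank 2 and lies on a tangent line of C_z,
  -- i.e. a line through a point vvᵀ of C_z meeting C_z only in vvᵀ.
  Exterior : Mat → Set
  Exterior z =
    Rank2 z ×
    Σ Vec3 λ u → Σ Vec3 λ w → LinIndep u w ×
      -- z lies in the plane of the conic C defined by ⟨u,w⟩ (this is C_z)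
      (Σ Carrier λ a → Σ Carrier λ b → Σ Carrier λ c →
         z ≈ ((a ⊙ outer u) ⊕ ((b ⊙ outer w) ⊕ (c ⊙ sym u w)))) ×
      -- a point vvᵀ of C such that the line ⟨vvᵀ, z⟩ is tangent to C
      (Σ Carrier λ s → Σ Carrier λ t → ¬ IsZeroV (lin s u t w) ×
         (∀ x y → ¬ IsZeroV (lin x u y w) →
            (Σ Carrier λ a → Σ Carrier λ b →
               outer (lin x u y w) ≈ ((a ⊙ outer (lin s u t w)) ⊕ (b ⊙ z))) →
            ProportionalV (lin x u y w) (lin s u t w)))

  Interior : Mat → Set
  Interior z = Rank2 z × ¬ Exterior z

  NumPoints : Mat → (Mat → Set) → ℕ → Set
  NumPoints A P n =
    Σ (List Mat) λ xs →
      length xs ≡ n ×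
      All (λ M → InPlane A M × ¬ IsZero M × P M) xs ×
      AllPairs (λ M N → ¬ (M ∼ N)) xs ×
      (∀ M → InPlane A M → ¬ IsZero M → P M → Any (λ N → M ∼ N) xs)

module Submission where

-- The plane is A π Aᵀ for an invertible A, where π = { S α β γ } with
-- S α β γ = (α 0 γ ; 0 β 0 ; γ 0 0).  The proof has two halves.
--
-- M ↦ A M Aᵀ is a linear action compatible with products
--   (MatrixAlgebra); it multiplies determinants by det(A)² and, by the
--   Cauchy–Binet formula, preserves the vanishing of all 2×2 minors.  It
--   maps conics, their planes and tangent lines to conics, planes and
--   tangent lines, so being of rank 1, 2, 3, exterior or interior is
--   invariant, and point counts in π carry over to A π Aᵀ (Invariance).
--
-- * Counting in π.  det S α β γ = - β γ².  Up to scalars the points are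
--   S 1 0 0, S 0 1 0 (rank 1); S α 0 1 (exterior, on the tangent at e₀e₀ᵀ
--   of the conic through e₀, e₂); S α 1 0 with α ≠ 0, which is exterior
--   iff - α is a square, since for any exterior point - (a b - c²) is a
--   square (StandardPlane); and S α β 1 with β ≠ 0 (rank 3).  In odd
--   order r ↦ - r² is two-to-one on F*, so k of the 2k nonzero α are of
--   the form - r² (FieldFacts, via fibre counting in Counting).  This gives
--   lists of 2, q + k, k and q (q - 1) points (Enumeration).

open import Defs
open import Algebra.Bundles using (CommutativeRing)
open import Relation.Binary.Definitions using (DecidableEquality)

-- The ring solver of the library, instantiated for an arbitrary
-- commutative ring with integer coefficients: ℤ maps homomorphically into
-- every ring via n ↦ n · 1.
module IntegerCoefficients {c ℓ} (R : CommutativeRing c ℓ) where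
  open import Data.Nat.Base as ℕ using (ℕ; zero; suc)
  open import Data.Integer.Base as ℤ using (ℤ; +_; -[1+_]; ∣_∣; sign; _◃_; _⊖_)
  import Data.Integer.Properties as ℤ
  import Data.Nat.Properties as ℕ
  open import Data.Sign.Base as Sign using (Sign)
  open import Data.Maybe.Base using (Maybe; just; nothing)
  open import Relation.Nullary.Decidable.Core using (yes; no)
  import Relation.Binary.PropositionalEquality.Core as ≡
  open import Algebra.Solver.Ring.AlmostCommutativeRing using (_-Raw-AlmostCommutative⟶_; fromCommutativeRing)

  open CommutativeRing R hiding (zero)
  open import Algebra.Properties.Ring ring using (-‿involutive; -‿distribˡ-*; -‿distribʳ-*; -0#≈0#)
  open import Algebra.Properties.AbelianGroup +-abelianGroup using (⁻¹-∙-comm)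
  open import Algebra.Properties.Semiring.Mult.TCOptimised semiring using (_×_; ×-homo-+; ×1-homo-*)
  open import Relation.Binary.Reasoning.Setoid setoid

  nat : ℕ → Carrier
  nat n = n × 1#

  signed : Sign → Carrier → Carrier
  signed Sign.+ x = x
  signed Sign.- x = - x

  ⟦_⟧ℤ : ℤ → Carrier
  ⟦ i ⟧ℤ = signed (sign i) (nat ∣ i ∣)

  nat-suc : ∀ n → nat (suc n) ≈ 1# + nat n
  nat-suc n = ×-homo-+ 1# 1 n

  ◃-homo : ∀ s n → ⟦ s ◃ n ⟧ℤ ≈ signed s (nat n)
  ◃-homo Sign.+ zero    = refl
  ◃-homo Sign.- zero    = sym -0#≈0#
  ◃-homo Sign.+ (suc n) = refl
  ◃-homo Sign.- (suc n) = refl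

  signed-* : ∀ s t x y → signed (s Sign.* t) (x * y) ≈ signed s x * signed t y
  signed-* Sign.+ Sign.+ x y = refl
  signed-* Sign.+ Sign.- x y = -‿distribʳ-* x y
  signed-* Sign.- Sign.+ x y = -‿distribˡ-* x y
  signed-* Sign.- Sign.- x y = begin
    x * y         ≈⟨ -‿involutive (x * y) ⟨
    - - (x * y)   ≈⟨ -‿cong (-‿distribʳ-* x y) ⟩
    - (x * - y)   ≈⟨ -‿distribˡ-* x (- y) ⟩
    - x * - y     ∎

  *-homo : ∀ i j → ⟦ i ℤ.* j ⟧ℤ ≈ ⟦ i ⟧ℤ * ⟦ j ⟧ℤ
  *-homo i j = begin
    ⟦ (sign i Sign.* sign j) ◃ (∣ i ∣ ℕ.* ∣ j ∣) ⟧ℤ     ≈⟨ ◃-homo (sign i Sign.* sign j) (∣ i ∣ ℕ.* ∣ j ∣) ⟩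
    signed (sign i Sign.* sign j) (nat (∣ i ∣ ℕ.* ∣ j ∣)) ≈⟨ signed-cong (sign i Sign.* sign j) (×1-homo-* ∣ i ∣ ∣ j ∣) ⟩
    signed (sign i Sign.* sign j) (nat ∣ i ∣ * nat ∣ j ∣) ≈⟨ signed-* (sign i) (sign j) _ _ ⟩
    ⟦ i ⟧ℤ * ⟦ j ⟧ℤ                                        ∎
    where
    signed-cong : ∀ s {x y} → x ≈ y → signed s x ≈ signed s y
    signed-cong Sign.+ e = e
    signed-cong Sign.- e = -‿cong e

  shift : ∀ a b → (1# + a) + (- 1# + b) ≈ a + b
  shift a b = begin
    (1# + a) + (- 1# + b) ≈⟨ +-assoc 1# a (- 1# + b) ⟩
    1# + (a + (- 1# + b)) ≈⟨ +-congˡ (+-congˡ (+-comm (- 1#) b)) ⟩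
    1# + (a + (b + - 1#)) ≈⟨ +-congˡ (+-assoc a b (- 1#)) ⟨
    1# + ((a + b) + - 1#) ≈⟨ +-comm 1# _ ⟩
    ((a + b) + - 1#) + 1# ≈⟨ +-assoc (a + b) (- 1#) 1# ⟩
    (a + b) + (- 1# + 1#) ≈⟨ +-congˡ (-‿inverseˡ 1#) ⟩
    (a + b) + 0#          ≈⟨ +-identityʳ (a + b) ⟩
    a + b                 ∎

  ⊖-homo : ∀ m n → ⟦ m ⊖ n ⟧ℤ ≈ nat m + - nat n
  ⊖-homo zero zero       = sym (trans (+-identityˡ _) -0#≈0#)
  ⊖-homo (suc m) zero    = begin
    ⟦ suc m ⊖ zero ⟧ℤ    ≡⟨ ≡.cong ⟦_⟧ℤ (ℤ.⊖-≥ {suc m} ℕ.z≤n) ⟩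
    nat (suc m)          ≈⟨ +-identityʳ _ ⟨
    nat (suc m) + 0#     ≈⟨ +-congˡ -0#≈0# ⟨
    nat (suc m) + - 0#   ∎
  ⊖-homo zero (suc n)    = begin
    ⟦ zero ⊖ suc n ⟧ℤ    ≡⟨ ≡.cong ⟦_⟧ℤ (ℤ.⊖-< {zero} {suc n} (ℕ.s≤s ℕ.z≤n)) ⟩
    - nat (suc n)        ≈⟨ +-identityˡ _ ⟨
    0# + - nat (suc n)   ∎
  ⊖-homo (suc m) (suc n) = begin
    ⟦ suc m ⊖ suc n ⟧ℤ               ≡⟨ ≡.cong ⟦_⟧ℤ (ℤ.[1+m]⊖[1+n]≡m⊖n m n) ⟩
    ⟦ m ⊖ n ⟧ℤ                       ≈⟨ ⊖-homo m n ⟩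
    nat m + - nat n                  ≈⟨ shift (nat m) (- nat n) ⟨
    (1# + nat m) + (- 1# + - nat n)  ≈⟨ +-cong (nat-suc m) (sym (⁻¹-∙-comm 1# (nat n))) ⟨
    nat (suc m) + - (1# + nat n)     ≈⟨ +-congˡ (-‿cong (nat-suc n)) ⟨
    nat (suc m) + - nat (suc n)      ∎

  +-homo : ∀ i j → ⟦ i ℤ.+ j ⟧ℤ ≈ ⟦ i ⟧ℤ + ⟦ j ⟧ℤ
  +-homo -[1+ m ] -[1+ n ] = begin
    - nat (suc (suc (m ℕ.+ n)))      ≡⟨ ≡.cong (λ k → - nat (suc k)) (≡.sym (ℕ.+-suc m n)) ⟩
    - nat (suc m ℕ.+ suc n)          ≈⟨ -‿cong (×-homo-+ 1# (suc m) (suc n)) ⟩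
    - (nat (suc m) + nat (suc n))    ≈⟨ ⁻¹-∙-comm _ _ ⟨
    - nat (suc m) + - nat (suc n)    ∎
  +-homo -[1+ m ] (+ n)    = trans (⊖-homo n (suc m)) (+-comm _ _)
  +-homo (+ m)    -[1+ n ] = ⊖-homo m (suc n)
  +-homo (+ m)    (+ n)    = ×-homo-+ 1# m n

  neg-homo : ∀ i → ⟦ ℤ.- i ⟧ℤ ≈ - ⟦ i ⟧ℤ
  neg-homo -[1+ n ]     = sym (-‿involutive _)
  neg-homo (+ zero)     = sym -0#≈0#
  neg-homo (+ (suc n))  = refl

  -- the morphism, and a (partial) decision of equality of the images of
  -- coefficients, which is all the solver needs
  morphism : ℤ.+-*-rawRing -Raw-AlmostCommutative⟶ fromCommutativeRing R
  morphism = record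
    { ⟦_⟧ = ⟦_⟧ℤ ; +-homo = +-homo ; *-homo = *-homo ; -‿homo = neg-homo ; 0-homo = refl ; 1-homo = refl }

  _≟-image_ : ∀ i j → Maybe (⟦ i ⟧ℤ ≈ ⟦ j ⟧ℤ)
  i ≟-image j with i ℤ.≟ j
  ... | yes ≡.refl = just refl
  ... | no  _      = nothing

  open import Algebra.Solver.Ring ℤ.+-*-rawRing (fromCommutativeRing R) morphism _≟-image_ public
    using (solve; _:=_; _:+_; _:*_; :-_; con; Polynomial)

  𝟎 𝟏 : ∀ {n} → Polynomial n
  𝟎 = con (+ 0)
  𝟏 = con (+ 1)

module Counting {A : Set} (_≟_ : DecidableEquality A) where
  open import Data.Nat.Base using (ℕ; suc; _+_; _*_)
  open import Data.Nat.Properties using (+-suc; *-distribˡ-+; +-commutativeSemigroup)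
  open import Algebra.Properties.CommutativeSemigroup +-commutativeSemigroup using (interchange)
  open import Data.List.Base using (List; []; _∷_; length; filter; map)
  open import Data.Nat.ListAction using (sum)
  open import Data.List.Relation.Unary.Any using (Any; here; there; any?)
  open import Data.List.Relation.Unary.Unique.Propositional using (Unique)
  open import Data.List.Relation.Unary.AllPairs using (_∷_)
  open import Data.List.Relation.Unary.All using (_∷_)
  import Data.List.Relation.Unary.Unique.Propositional.Properties as Unique
  open import Data.List.Membership.Propositional using (_∈_; find)
  open import Data.List.Membership.Propositional.Properties using (∈-filter⁺; ∈-filter⁻)
  open import Data.Product.Base using (_,_; proj₂)
  open import Data.Sum.Base using (_⊎_; inj₁; inj₂)
  open import Data.Empty using (⊥-elim)
  open import Relation.Nullary using (yes; no; ¬?)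
  open import Level using (0ℓ)
  open import Relation.Unary using (Pred; Decidable)
  open import Relation.Binary.PropositionalEquality

  length-partition : ∀ {P : Pred A 0ℓ} (P? : Decidable P) xs →
    length xs ≡ length (filter P? xs) + length (filter (λ x → ¬? (P? x)) xs)
  length-partition P? [] = refl
  length-partition P? (x ∷ xs) with P? x
  ... | yes _ = cong suc (length-partition P? xs)
  ... | no  _ = trans (cong suc (length-partition P? xs)) (sym (+-suc _ _))

  length-singleton : ∀ {xs : List A} {y : A} → Unique xs → (∀ {x} → x ∈ xs → x ≡ y) → y ∈ xs → length xs ≡ 1
  length-singleton {x ∷ []} _ _ _ = refl
  length-singleton {x ∷ x′ ∷ _} ((x≢x′ ∷ _) ∷ _) only _ =
    ⊥-elim (x≢x′ (trans (only (here refl)) (sym (only (there (here refl))))))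

  length-pair : ∀ {xs : List A} {a b : A} → Unique xs → (∀ {x} → x ∈ xs → x ≡ a ⊎ x ≡ b) →
                a ∈ xs → b ∈ xs → a ≢ b → length xs ≡ 2
  length-pair {xs} {a} {b} u only a∈ b∈ a≢b =
    trans (length-partition (_≟ a) xs) (cong₂ _+_ as bs)
    where
    as : length (filter (_≟ a) xs) ≡ 1
    as = length-singleton {filter (_≟ a) xs} (Unique.filter⁺ (_≟ a) {xs} u) (λ m → proj₂ (∈-filter⁻ (_≟ a) {xs = xs} m))
                          (∈-filter⁺ (_≟ a) a∈ refl)
    onlyB : ∀ {x} → x ∈ xs → x ≢ a → x ≡ b
    onlyB m x≢a with only m
    ... | inj₁ x≡a = ⊥-elim (x≢a x≡a)
    ... | inj₂ x≡b = x≡b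
    bs : length (filter (λ x → ¬? (x ≟ a)) xs) ≡ 1
    bs = length-singleton {filter (λ x → ¬? (x ≟ a)) xs} (Unique.filter⁺ (λ x → ¬? (x ≟ a)) {xs} u)
           (λ m → let m′ , x≢a = ∈-filter⁻ (λ x → ¬? (x ≟ a)) {xs = xs} m in onlyB m′ x≢a)
           (∈-filter⁺ (λ x → ¬? (x ≟ a)) b∈ (λ b≡a → a≢b (sym b≡a)))

  indicator : ∀ {P : Pred A 0ℓ} → Decidable P → A → ℕ
  indicator P? x with P? x
  ... | yes _ = 1
  ... | no  _ = 0

  sum-indicator : ∀ {P : Pred A 0ℓ} (P? : Decidable P) xs →
                  sum (map (indicator P?) xs) ≡ length (filter P? xs)
  sum-indicator P? [] = refl
  sum-indicator P? (x ∷ xs) with P? x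
  ... | yes _ = cong suc (sum-indicator P? xs)
  ... | no  _ = sum-indicator P? xs

  sum-cong : ∀ xs {f g : A → ℕ} → (∀ {x} → x ∈ xs → f x ≡ g x) → sum (map f xs) ≡ sum (map g xs)
  sum-cong [] _ = refl
  sum-cong (x ∷ xs) f≡g = cong₂ _+_ (f≡g (here refl)) (sum-cong xs (λ m → f≡g (there m)))

  sum-+ : ∀ xs (f g : A → ℕ) → sum (map (λ x → f x + g x) xs) ≡ sum (map f xs) + sum (map g xs)
  sum-+ [] f g = refl
  sum-+ (x ∷ xs) f g = trans (cong (f x + g x +_) (sum-+ xs f g)) (interchange (f x) (g x) _ _)

  sum-2* : ∀ xs (f : A → ℕ) → sum (map (λ x → 2 * f x) xs) ≡ 2 * sum (map f xs)
  sum-2* [] f = refl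
  sum-2* (x ∷ xs) f = trans (cong (2 * f x +_) (sum-2* xs f)) (sym (*-distribˡ-+ 2 (f x) _))

  module TwoToOne (h σ : A → A) {D C : List A} (uD : Unique D) (uC : Unique C)
                  (h∈C : ∀ {r} → r ∈ D → h r ∈ C)
                  (σ∈D : ∀ {r} → r ∈ D → σ r ∈ D)
                  (σ-moves : ∀ {r} → r ∈ D → r ≢ σ r)
                  (h∘σ : ∀ {r} → r ∈ D → h (σ r) ≡ h r)
                  (fibre : ∀ {r r′} → r ∈ D → r′ ∈ D → h r′ ≡ h r → r′ ≡ r ⊎ r′ ≡ σ r) where

    InImage : A → Set
    InImage c = Any (λ r → h r ≡ c) D

    inImage? : Decidable InImage
    inImage? c = any? (λ r → h r ≟ c) D

    fibreSize : List A → A → ℕ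
    fibreSize D′ c = length (filter (λ r → h r ≟ c) D′)

    sum-fibreSize : ∀ D′ → (∀ {r} → r ∈ D′ → h r ∈ C) → sum (map (fibreSize D′) C) ≡ length D′
    sum-fibreSize [] _ = sum-zero C
      where
      sum-zero : ∀ xs → sum (map (λ _ → 0) xs) ≡ 0
      sum-zero [] = refl
      sum-zero (_ ∷ xs) = sum-zero xs
    sum-fibreSize (r ∷ D′) h∈ = begin
      sum (map (fibreSize (r ∷ D′)) C)                         ≡⟨ sum-cong C (λ {c} _ → fibreSize-∷ c) ⟩
      sum (map (λ c → indicator (h r ≟_) c + fibreSize D′ c) C) ≡⟨ sum-+ C _ _ ⟩
      sum (map (indicator (h r ≟_)) C) + sum (map (fibreSize D′) C)
        ≡⟨ cong₂ _+_ (sum-indicator (h r ≟_) C) (sum-fibreSize D′ (λ m → h∈ (there m))) ⟩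
      length (filter (h r ≟_) C) + length D′                    ≡⟨ cong (_+ length D′) hr-once ⟩
      suc (length D′)                                           ∎
      where
      open ≡-Reasoning
      fibreSize-∷ : ∀ c → fibreSize (r ∷ D′) c ≡ indicator (h r ≟_) c + fibreSize D′ c
      fibreSize-∷ c with h r ≟ c
      ... | yes _ = refl
      ... | no  _ = refl
      hr-once : length (filter (h r ≟_) C) ≡ 1
      hr-once = length-singleton {filter (h r ≟_) C} (Unique.filter⁺ (h r ≟_) {C} uC)
                  (λ m → sym (proj₂ (∈-filter⁻ (h r ≟_) {xs = C} m))) (∈-filter⁺ (h r ≟_) (h∈ (here refl)) refl)

    fibreSize-D : ∀ c → fibreSize D c ≡ 2 * indicator inImage? c
    fibreSize-D c with inImage? c
    ... | no ¬img = cong length (filter-empty D (λ m hr≡c → ¬img (∈⇒Any m hr≡c)))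
      where
      ∈⇒Any : ∀ {r xs} → r ∈ xs → h r ≡ c → Any (λ r → h r ≡ c) xs
      ∈⇒Any (here refl) e = here e
      ∈⇒Any (there m) e = there (∈⇒Any m e)
      filter-empty : ∀ xs → (∀ {r} → r ∈ xs → h r ≢ c) → filter (λ r → h r ≟ c) xs ≡ []
      filter-empty [] _ = refl
      filter-empty (r ∷ xs) none with h r ≟ c
      ... | yes hr≡c = ⊥-elim (none (here refl) hr≡c)
      ... | no  _    = filter-empty xs (λ m → none (there m))
    ... | yes img with find img
    ... | r , r∈D , hr≡c =
      length-pair {filter (λ r → h r ≟ c) D} (Unique.filter⁺ (λ r → h r ≟ c) {D} uD)
        (λ m → let m′ , hr′≡c = ∈-filter⁻ (λ r → h r ≟ c) {xs = D} m in fibre r∈D m′ (trans hr′≡c (sym hr≡c)))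
        (∈-filter⁺ (λ r → h r ≟ c) r∈D hr≡c)
        (∈-filter⁺ (λ r → h r ≟ c) (σ∈D r∈D) (trans (h∘σ r∈D) hr≡c))
        (σ-moves r∈D)

    length-two-to-one : length D ≡ 2 * length (filter inImage? C)
    length-two-to-one = begin
      length D                                   ≡⟨ sum-fibreSize D h∈C ⟨
      sum (map (fibreSize D) C)                  ≡⟨ sum-cong C (λ {c} _ → fibreSize-D c) ⟩
      sum (map (λ c → 2 * indicator inImage? c) C) ≡⟨ sum-2* C _ ⟩
      2 * sum (map (indicator inImage?) C)       ≡⟨ cong (2 *_) (sum-indicator inImage? C) ⟩
      2 * length (filter inImage? C)             ∎
      where open ≡-Reasoning

module FieldFacts (F : FiniteField) where
  open import Level using (0ℓ)
  open import Algebra.Bundles using (CommutativeRing)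
  open import Data.Nat.Base as ℕ using (ℕ; suc)
  import Data.Nat.Properties as ℕ
  open import Data.List.Base using (List; length; filter)
  open import Data.List.Relation.Unary.Any using (Any; any?)
  open import Data.List.Relation.Unary.Unique.Propositional using (Unique)
  import Data.List.Relation.Unary.Unique.Propositional.Properties as Unique
  open import Data.List.Membership.Propositional using (_∈_)
  open import Data.List.Membership.Propositional.Properties using (∈-filter⁺; ∈-filter⁻)
  open import Data.Product.Base using (_,_; proj₁; proj₂)
  open import Data.Sum.Base using (_⊎_; inj₁; inj₂)
  open import Relation.Nullary using (¬_; yes; no; ¬?)
  open import Relation.Unary using (Decidable)
  open import Relation.Binary.PropositionalEquality
  open FiniteField F

  commutativeRing : CommutativeRing 0ℓ 0ℓ
  commutativeRing = record { isCommutativeRing = isCommutativeRing }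

  open CommutativeRing commutativeRing public
    using (+-comm; *-assoc; *-comm; *-identityˡ; *-identityʳ; zeroˡ; zeroʳ; -‿inverseʳ)
  open IntegerCoefficients commutativeRing public
    using (solve; _:=_; _:+_; _:*_; :-_; 𝟎; 𝟏; Polynomial)
  open import Algebra.Properties.Ring (CommutativeRing.ring commutativeRing) public
    using (-‿involutive; -0#≈0#)
  open import Algebra.Properties.Group (CommutativeRing.+-group commutativeRing) public
    using (x∙y⁻¹≈ε⇒x≈y; x≈y⇒x∙y⁻¹≈ε; inverseˡ-unique)

  1≢0 : 1# ≢ 0#
  1≢0 1≡0 = 0≢1 (sym 1≡0)

  inv : (x : Carrier) → x ≢ 0# → Carrier
  inv x x≢0 = proj₁ (inverse x x≢0)

  inv-r : ∀ x (x≢0 : x ≢ 0#) → x * inv x x≢0 ≡ 1#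
  inv-r x x≢0 = proj₂ (inverse x x≢0)

  inv-l : ∀ x (x≢0 : x ≢ 0#) → inv x x≢0 * x ≡ 1#
  inv-l x x≢0 = trans (*-comm _ x) (inv-r x x≢0)

  inv-nonzero : ∀ x (x≢0 : x ≢ 0#) → inv x x≢0 ≢ 0#
  inv-nonzero x x≢0 i≡0 = 0≢1 (begin
    0#             ≡⟨ sym (zeroʳ x) ⟩
    x * 0#         ≡⟨ cong (x *_) i≡0 ⟨
    x * inv x x≢0  ≡⟨ inv-r x x≢0 ⟩
    1#             ∎)
    where open ≡-Reasoning

  *-inv-cancel : ∀ x c (c≢0 : c ≢ 0#) → x ≡ c * (x * inv c c≢0)
  *-inv-cancel x c c≢0 = sym (begin
    c * (x * inv c c≢0)  ≡⟨ solve 3 (λ c x i → c :* (x :* i) := x :* (c :* i)) refl c x (inv c c≢0) ⟩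
    x * (c * inv c c≢0)  ≡⟨ cong (x *_) (inv-r c c≢0) ⟩
    x * 1#               ≡⟨ *-identityʳ x ⟩
    x                    ∎)
    where open ≡-Reasoning

  no-zero-divisors : ∀ {x y} → x * y ≡ 0# → x ≡ 0# ⊎ y ≡ 0#
  no-zero-divisors {x} {y} xy≡0 with x ≟ 0#
  ... | yes x≡0 = inj₁ x≡0
  ... | no  x≢0 = inj₂ (begin
    y                    ≡⟨ *-identityˡ y ⟨
    1# * y               ≡⟨ cong (_* y) (inv-l x x≢0) ⟨
    (inv x x≢0 * x) * y  ≡⟨ *-assoc _ x y ⟩
    inv x x≢0 * (x * y)  ≡⟨ cong (inv x x≢0 *_) xy≡0 ⟩
    inv x x≢0 * 0#       ≡⟨ zeroʳ _ ⟩
    0#                   ∎)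
    where open ≡-Reasoning

  *-nonzero : ∀ {x y} → x ≢ 0# → y ≢ 0# → x * y ≢ 0#
  *-nonzero x≢0 y≢0 xy≡0 with no-zero-divisors xy≡0
  ... | inj₁ x≡0 = x≢0 x≡0
  ... | inj₂ y≡0 = y≢0 y≡0

  square-zero : ∀ {x} → x * x ≡ 0# → x ≡ 0#
  square-zero xx≡0 with no-zero-divisors xx≡0
  ... | inj₁ x≡0 = x≡0
  ... | inj₂ x≡0 = x≡0

  neg-zero : ∀ {x} → - x ≡ 0# → x ≡ 0#
  neg-zero {x} -x≡0 = trans (sym (-‿involutive x)) (trans (cong -_ -x≡0) -0#≈0#)

  neg-nonzero : ∀ {x} → x ≢ 0# → - x ≢ 0#
  neg-nonzero x≢0 -x≡0 = x≢0 (neg-zero -x≡0)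

  nonzero? : Decidable (_≢ 0#)
  nonzero? x = ¬? (x ≟ 0#)

  nonzeros : List Carrier
  nonzeros = filter nonzero? elements

  nonzeros-unique : Unique nonzeros
  nonzeros-unique = Unique.filter⁺ nonzero? {elements} elements-unique

  ∈-nonzeros⁺ : ∀ {x} → x ≢ 0# → x ∈ nonzeros
  ∈-nonzeros⁺ {x} x≢0 = ∈-filter⁺ nonzero? (elements-complete x) x≢0

  ∈-nonzeros⁻ : ∀ {x} → x ∈ nonzeros → x ≢ 0#
  ∈-nonzeros⁻ m = proj₂ (∈-filter⁻ nonzero? {xs = elements} m)

  open Counting _≟_

  order-nonzeros : order ≡ suc (length nonzeros)
  order-nonzeros = trans (length-partition (_≟ 0#) elements) (cong (ℕ._+ length nonzeros) zeros)
    where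
    zeros : length (filter (_≟ 0#) elements) ≡ 1
    zeros = length-singleton {filter (_≟ 0#) elements} (Unique.filter⁺ (_≟ 0#) {elements} elements-unique)
              (λ m → proj₂ (∈-filter⁻ (_≟ 0#) {xs = elements} m))
              (∈-filter⁺ (_≟ 0#) (elements-complete 0#) refl)

  -- In characteristic 2 the translation x ↦ x + 1 pairs off the elements
  -- of F (as the fibres of x ↦ x (x + 1)), so a field of odd order has
  -- 1 + 1 ≢ 0.
  odd-order⇒2≢0 : ∀ k → order ≡ suc (2 ℕ.* k) → 1# + 1# ≢ 0#
  odd-order⇒2≢0 k order≡ 2≡0 =
    ℕ.even≢odd (length (filter Pairs.inImage? elements)) k (trans (sym Pairs.length-two-to-one) order≡)
    where
    h σ : Carrier → Carrier
    h x = x * (x + 1#)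
    σ x = x + 1#

    neg-self : ∀ x → - x ≡ x
    neg-self x = sym (x∙y⁻¹≈ε⇒x≈y x (- x) (begin
      x + - - x        ≡⟨ cong (x +_) (-‿involutive x) ⟩
      x + x            ≡⟨ solve 1 (λ x → x :+ x := x :* (𝟏 :+ 𝟏)) refl x ⟩
      x * (1# + 1#)    ≡⟨ cong (x *_) 2≡0 ⟩
      x * 0#           ≡⟨ zeroʳ x ⟩
      0#               ∎))
      where open ≡-Reasoning

    σ-moves : ∀ {r} → r ∈ elements → r ≢ σ r
    σ-moves {r} _ r≡r+1 = 1≢0 (begin
      1#                ≡⟨ solve 1 (λ r → 𝟏 := (r :+ 𝟏) :+ :- r) refl r ⟩
      (r + 1#) + - r    ≡⟨ cong (_+ - r) r≡r+1 ⟨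
      r + - r           ≡⟨ -‿inverseʳ r ⟩
      0#                ∎)
      where open ≡-Reasoning

    h∘σ : ∀ {r} → r ∈ elements → h (σ r) ≡ h r
    h∘σ {r} _ = begin
      (r + 1#) * (r + 1# + 1#)              ≡⟨ solve 1 (λ r → (r :+ 𝟏) :* (r :+ 𝟏 :+ 𝟏) := (r :+ 𝟏) :* r :+ (r :+ 𝟏) :* (𝟏 :+ 𝟏)) refl r ⟩
      (r + 1#) * r + (r + 1#) * (1# + 1#)   ≡⟨ cong (λ t → (r + 1#) * r + (r + 1#) * t) 2≡0 ⟩
      (r + 1#) * r + (r + 1#) * 0#          ≡⟨ solve 1 (λ r → (r :+ 𝟏) :* r :+ (r :+ 𝟏) :* 𝟎 := r :* (r :+ 𝟏)) refl r ⟩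
      r * (r + 1#)                          ∎
      where open ≡-Reasoning

    -- h r′ - h r = (r′ - r)(r′ + r + 1)
    fibre : ∀ {r r′} → r ∈ elements → r′ ∈ elements → h r′ ≡ h r → r′ ≡ r ⊎ r′ ≡ σ r
    fibre {r} {r′} _ _ hr′≡hr with no-zero-divisors (trans factor (x≈y⇒x∙y⁻¹≈ε hr′≡hr))
      where
      factor : (r′ + - r) * (r′ + (r + 1#)) ≡ h r′ + - h r
      factor = solve 2 (λ r′ r → (r′ :+ :- r) :* (r′ :+ (r :+ 𝟏)) := r′ :* (r′ :+ 𝟏) :+ :- (r :* (r :+ 𝟏))) refl r′ r
    ... | inj₁ d≡0 = inj₁ (x∙y⁻¹≈ε⇒x≈y r′ r d≡0)
    ... | inj₂ s≡0 = inj₂ (x∙y⁻¹≈ε⇒x≈y r′ (σ r) (trans (cong (r′ +_) (neg-self (σ r))) s≡0))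

    module Pairs = TwoToOne h σ elements-unique elements-unique
                     (λ {r} _ → elements-complete (h r)) (λ {r} _ → elements-complete (σ r))
                     σ-moves h∘σ fibre

  NegSquare : Carrier → Set
  NegSquare c = Any (λ r → - (r * r) ≡ c) nonzeros

  negSquare? : Decidable NegSquare
  negSquare? c = any? (λ r → (- (r * r)) ≟ c) nonzeros

  negSquares nonNegSquares : List Carrier
  negSquares    = filter negSquare? nonzeros
  nonNegSquares = filter (λ c → ¬? (negSquare? c)) nonzeros

  negSquares-unique : Unique negSquares
  negSquares-unique = Unique.filter⁺ negSquare? {nonzeros} nonzeros-unique

  nonNegSquares-unique : Unique nonNegSquares
  nonNegSquares-unique = Unique.filter⁺ (λ c → ¬? (negSquare? c)) {nonzeros} nonzeros-unique

  -- In odd order, r ↦ - r² is two-to-one on the nonzero elements (its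
  -- fibres are the pairs {r, - r}), so exactly half of the q - 1 nonzero
  -- elements are of the form - r².
  module OddOrder (k : ℕ) (order≡ : order ≡ suc (2 ℕ.* k)) where

    length-nonzeros : length nonzeros ≡ 2 ℕ.* k
    length-nonzeros = ℕ.suc-injective (trans (sym order-nonzeros) order≡)

    private
      h : Carrier → Carrier
      h r = - (r * r)

      neg-moves : ∀ {r} → r ∈ nonzeros → r ≢ - r
      neg-moves {r} r∈ r≡-r with no-zero-divisors (trans twice (trans (cong (r +_) r≡-r) (-‿inverseʳ r)))
        where
        twice : r * (1# + 1#) ≡ r + r
        twice = solve 1 (λ r → r :* (𝟏 :+ 𝟏) := r :+ r) refl r
      ... | inj₁ r≡0 = ∈-nonzeros⁻ r∈ r≡0
      ... | inj₂ 2≡0 = odd-order⇒2≢0 k order≡ 2≡0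

      -- h r′ - h r = (r - r′)(r + r′)
      fibre : ∀ {r r′} → r ∈ nonzeros → r′ ∈ nonzeros → h r′ ≡ h r → r′ ≡ r ⊎ r′ ≡ - r
      fibre {r} {r′} _ _ hr′≡hr with no-zero-divisors (trans factor (x≈y⇒x∙y⁻¹≈ε hr′≡hr))
        where
        factor : (r + - r′) * (r + r′) ≡ h r′ + - h r
        factor = solve 2 (λ r r′ → (r :+ :- r′) :* (r :+ r′) := :- (r′ :* r′) :+ :- (:- (r :* r))) refl r r′
      ... | inj₁ d≡0 = inj₁ (sym (x∙y⁻¹≈ε⇒x≈y r r′ d≡0))
      ... | inj₂ s≡0 = inj₂ (x∙y⁻¹≈ε⇒x≈y r′ (- r) (trans (cong (r′ +_) (-‿involutive r)) (trans (+-comm r′ r) s≡0)))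

      module Pairs = TwoToOne h -_ nonzeros-unique nonzeros-unique
        (λ m → ∈-nonzeros⁺ (neg-nonzero (*-nonzero (∈-nonzeros⁻ m) (∈-nonzeros⁻ m))))
        (λ m → ∈-nonzeros⁺ (neg-nonzero (∈-nonzeros⁻ m)))
        neg-moves
        (λ {r} _ → cong -_ (solve 1 (λ r → (:- r) :* (:- r) := r :* r) refl r))
        fibre

    length-negSquares : length negSquares ≡ k
    length-negSquares = ℕ.*-cancelˡ-≡ _ k 2 (trans (sym Pairs.length-two-to-one) length-nonzeros)

    length-nonNegSquares : length nonNegSquares ≡ k
    length-nonNegSquares = ℕ.+-cancelˡ-≡ k _ k (begin
      k ℕ.+ length nonNegSquares                   ≡⟨ cong (ℕ._+ length nonNegSquares) length-negSquares ⟨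
      length negSquares ℕ.+ length nonNegSquares   ≡⟨ length-partition negSquare? nonzeros ⟨
      length nonzeros                              ≡⟨ length-nonzeros ⟩
      2 ℕ.* k                                      ≡⟨ cong (k ℕ.+_) (ℕ.+-identityʳ k) ⟩
      k ℕ.+ k                                      ∎)
      where open ≡-Reasoning

module MatrixAlgebra (F : FiniteField) where
  open import Data.Nat.Base using (ℕ)
  open import Data.Product.Base using (_,_)
  open import Data.Fin.Base using (Fin; zero; suc)
  open import Relation.Binary.PropositionalEquality
  open import Relation.Binary.Bundles using (Setoid)
  open import Level using (0ℓ)
  open FiniteField F
  open Geometry F renaming (sym to sym-product)
  open FieldFacts F

  pattern i₀ = zero
  pattern i₁ = suc zero
  pattern i₂ = suc (suc zero)

  -- Symbolic counterparts of sum3, vectors and matrices, for stating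
  -- entrywise identities to the ring solver.
  module Symbolic {n : ℕ} where
    Σₑ : (Fin 3 → Polynomial n) → Polynomial n
    Σₑ f = f i₀ :+ f i₁ :+ f i₂

    vecₑ : (x₀ x₁ x₂ : Polynomial n) → Fin 3 → Polynomial n
    vecₑ x₀ x₁ x₂ i₀ = x₀
    vecₑ x₀ x₁ x₂ i₁ = x₁
    vecₑ x₀ x₁ x₂ i₂ = x₂

    matₑ : (x₀₀ x₀₁ x₀₂ x₁₀ x₁₁ x₁₂ x₂₀ x₂₁ x₂₂ : Polynomial n) → Fin 3 → Fin 3 → Polynomial n
    matₑ x₀₀ x₀₁ x₀₂ x₁₀ x₁₁ x₁₂ x₂₀ x₂₁ x₂₂ i₀ = vecₑ x₀₀ x₀₁ x₀₂
    matₑ x₀₀ x₀₁ x₀₂ x₁₀ x₁₁ x₁₂ x₂₀ x₂₁ x₂₂ i₁ = vecₑ x₁₀ x₁₁ x₁₂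
    matₑ x₀₀ x₀₁ x₀₂ x₁₀ x₁₁ x₁₂ x₂₀ x₂₁ x₂₂ i₂ = vecₑ x₂₀ x₂₁ x₂₂

    _·ₑ_ : (a b : Fin 3 → Fin 3 → Polynomial n) → Fin 3 → Fin 3 → Polynomial n
    (a ·ₑ b) i j = Σₑ (λ k → a i k :* b k j)

    transposeₑ : (Fin 3 → Fin 3 → Polynomial n) → Fin 3 → Fin 3 → Polynomial n
    transposeₑ a i j = a j i

    minorₑ : (Fin 3 → Fin 3 → Polynomial n) → Fin 3 → Fin 3 → Fin 3 → Fin 3 → Polynomial n
    minorₑ m i j k l = m i k :* m j l :+ :- (m i l :* m j k)

    detₑ : (Fin 3 → Fin 3 → Polynomial n) → Polynomial n
    detₑ m = Σₑ (λ k → m i₀ k :* cofactor k)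
      where
      cofactor : Fin 3 → Polynomial n
      cofactor i₀ = minorₑ m i₁ i₂ i₁ i₂
      cofactor i₁ = :- minorₑ m i₁ i₂ i₀ i₂
      cofactor i₂ = minorₑ m i₁ i₂ i₀ i₁

  open Symbolic

  sum3-cong : ∀ {f g : Fin 3 → Carrier} → f ≗ g → sum3 f ≡ sum3 g
  sum3-cong f≗g = cong₂ _+_ (cong₂ _+_ (f≗g i₀) (f≗g i₁)) (f≗g i₂)

  sum3-swap : ∀ (f : Fin 3 → Fin 3 → Carrier) → sum3 (λ k → sum3 (f k)) ≡ sum3 (λ l → sum3 (λ k → f k l))
  sum3-swap f = solve 9 (λ a b c d e g h i j →
      Σₑ (λ k → Σₑ (matₑ a b c d e g h i j k))
    := Σₑ (λ l → Σₑ (λ k → matₑ a b c d e g h i j k l))) refl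
    (f i₀ i₀) (f i₀ i₁) (f i₀ i₂) (f i₁ i₀) (f i₁ i₁) (f i₁ i₂) (f i₂ i₀) (f i₂ i₁) (f i₂ i₂)

  sum3-distribʳ : ∀ (f : Fin 3 → Carrier) c → sum3 f * c ≡ sum3 (λ k → f k * c)
  sum3-distribʳ f c = solve 4 (λ a b d c → Σₑ (vecₑ a b d) :* c := Σₑ (λ k → vecₑ a b d k :* c)) refl
    (f i₀) (f i₁) (f i₂) c

  sum3-distribˡ : ∀ c (f : Fin 3 → Carrier) → c * sum3 f ≡ sum3 (λ k → c * f k)
  sum3-distribˡ c f = solve 4 (λ c a b d → c :* Σₑ (vecₑ a b d) := Σₑ (λ k → c :* vecₑ a b d k)) refl
    c (f i₀) (f i₁) (f i₂)

  ≈-refl : ∀ {M} → M ≈ M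
  ≈-refl i j = refl

  ≈-sym : ∀ {M N} → M ≈ N → N ≈ M
  ≈-sym M≈N i j = sym (M≈N i j)

  ≈-trans : ∀ {M N P} → M ≈ N → N ≈ P → M ≈ P
  ≈-trans M≈N N≈P i j = trans (M≈N i j) (N≈P i j)

  ≈-setoid : Setoid 0ℓ 0ℓ
  ≈-setoid = record { Carrier = Mat ; _≈_ = _≈_
                    ; isEquivalence = record { refl = ≈-refl ; sym = ≈-sym ; trans = ≈-trans } }

  ·-cong : ∀ {A A′ B B′} → A ≈ A′ → B ≈ B′ → (A · B) ≈ (A′ · B′)
  ·-cong A≈A′ B≈B′ i j = sum3-cong (λ k → cong₂ _*_ (A≈A′ i k) (B≈B′ k j))

  transpose-cong : ∀ {A A′} → A ≈ A′ → transpose A ≈ transpose A′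
  transpose-cong A≈A′ i j = A≈A′ j i

  ·-assoc : ∀ A B C → ((A · B) · C) ≈ (A · (B · C))
  ·-assoc A B C i j = begin
    sum3 (λ k → sum3 (λ l → A i l * B l k) * C k j)    ≡⟨ sum3-cong (λ k → sum3-distribʳ (λ l → A i l * B l k) (C k j)) ⟩
    sum3 (λ k → sum3 (λ l → A i l * B l k * C k j))    ≡⟨ sum3-swap (λ k l → A i l * B l k * C k j) ⟩
    sum3 (λ l → sum3 (λ k → A i l * B l k * C k j))    ≡⟨ sum3-cong (λ l → sum3-cong (λ k → *-assoc (A i l) (B l k) (C k j))) ⟩
    sum3 (λ l → sum3 (λ k → A i l * (B l k * C k j)))  ≡⟨ sum3-cong (λ l → sum3-distribˡ (A i l) (λ k → B l k * C k j)) ⟨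
    sum3 (λ l → A i l * sum3 (λ k → B l k * C k j))    ∎
    where open ≡-Reasoning

  transpose-· : ∀ A B → transpose (A · B) ≈ (transpose B · transpose A)
  transpose-· A B i j = sum3-cong (λ k → *-comm (A j k) (B k i))

  ·-identityˡ : ∀ A → (identity · A) ≈ A
  ·-identityˡ A i₀ j = solve 3 (λ x y z → 𝟏 :* x :+ 𝟎 :* y :+ 𝟎 :* z := x) refl (A i₀ j) (A i₁ j) (A i₂ j)
  ·-identityˡ A i₁ j = solve 3 (λ x y z → 𝟎 :* x :+ 𝟏 :* y :+ 𝟎 :* z := y) refl (A i₀ j) (A i₁ j) (A i₂ j)
  ·-identityˡ A i₂ j = solve 3 (λ x y z → 𝟎 :* x :+ 𝟎 :* y :+ 𝟏 :* z := z) refl (A i₀ j) (A i₁ j) (A i₂ j)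

  ·-identityʳ : ∀ A → (A · identity) ≈ A
  ·-identityʳ A i i₀ = solve 3 (λ x y z → x :* 𝟏 :+ y :* 𝟎 :+ z :* 𝟎 := x) refl (A i i₀) (A i i₁) (A i i₂)
  ·-identityʳ A i i₁ = solve 3 (λ x y z → x :* 𝟎 :+ y :* 𝟏 :+ z :* 𝟎 := y) refl (A i i₀) (A i i₁) (A i i₂)
  ·-identityʳ A i i₂ = solve 3 (λ x y z → x :* 𝟎 :+ y :* 𝟎 :+ z :* 𝟏 := z) refl (A i i₀) (A i i₁) (A i i₂)

  transpose-identity : transpose identity ≈ identity
  transpose-identity i₀ i₀ = refl
  transpose-identity i₀ i₁ = refl
  transpose-identity i₀ i₂ = refl
  transpose-identity i₁ i₀ = refl
  transpose-identity i₁ i₁ = refl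
  transpose-identity i₁ i₂ = refl
  transpose-identity i₂ i₀ = refl
  transpose-identity i₂ i₁ = refl
  transpose-identity i₂ i₂ = refl

  act-cong : ∀ {A A′ M M′} → A ≈ A′ → M ≈ M′ → act A M ≈ act A′ M′
  act-cong A≈A′ M≈M′ = ·-cong (·-cong A≈A′ M≈M′) (transpose-cong A≈A′)

  act-∘ : ∀ B A M → act B (act A M) ≈ act (B · A) M
  act-∘ B A M = begin
    (B · ((A · M) · transpose A)) · transpose B     ≈⟨ ·-cong (≈-sym (·-assoc B (A · M) (transpose A))) (≈-refl {transpose B}) ⟩
    ((B · (A · M)) · transpose A) · transpose B     ≈⟨ ·-assoc (B · (A · M)) (transpose A) (transpose B) ⟩
    (B · (A · M)) · (transpose A · transpose B)     ≈⟨ ·-cong (≈-sym (·-assoc B A M)) (≈-sym (transpose-· B A)) ⟩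
    ((B · A) · M) · transpose (B · A)               ∎
    where open import Relation.Binary.Reasoning.Setoid ≈-setoid

  act-identity : ∀ M → act identity M ≈ M
  act-identity M = begin
    (identity · M) · transpose identity   ≈⟨ ·-cong (·-identityˡ M) transpose-identity ⟩
    M · identity                          ≈⟨ ·-identityʳ M ⟩
    M                                     ∎
    where open import Relation.Binary.Reasoning.Setoid ≈-setoid

  act-inverse : ∀ {A B} → (B · A) ≈ identity → ∀ M → act B (act A M) ≈ M
  act-inverse {A} {B} BA≈I M = ≈-trans (act-∘ B A M) (≈-trans (act-cong BA≈I (≈-refl {M})) (act-identity M))

  _▹_ : Mat → Vec3 → Vec3
  (A ▹ v) i = sum3 (λ k → A i k * v k)

  ▹-cong : ∀ A {v v′} → v ≗ v′ → (A ▹ v) ≗ (A ▹ v′)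
  ▹-cong A v≗v′ i = sum3-cong (λ k → cong (A i k *_) (v≗v′ k))

  ▹-∘ : ∀ B A v → (B ▹ (A ▹ v)) ≗ ((B · A) ▹ v)
  ▹-∘ B A v i = begin
    sum3 (λ l → B i l * sum3 (λ k → A l k * v k))   ≡⟨ sum3-cong (λ l → sum3-distribˡ (B i l) (λ k → A l k * v k)) ⟩
    sum3 (λ l → sum3 (λ k → B i l * (A l k * v k))) ≡⟨ sum3-swap (λ l k → B i l * (A l k * v k)) ⟩
    sum3 (λ k → sum3 (λ l → B i l * (A l k * v k))) ≡⟨ sum3-cong (λ k → sum3-cong (λ l → *-assoc (B i l) (A l k) (v k))) ⟨
    sum3 (λ k → sum3 (λ l → B i l * A l k * v k))   ≡⟨ sum3-cong (λ k → sum3-distribʳ (λ l → B i l * A l k) (v k)) ⟨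
    sum3 (λ k → sum3 (λ l → B i l * A l k) * v k)   ∎
    where open ≡-Reasoning

  ▹-identity : ∀ v → (identity ▹ v) ≗ v
  ▹-identity v i₀ = solve 3 (λ x y z → 𝟏 :* x :+ 𝟎 :* y :+ 𝟎 :* z := x) refl (v i₀) (v i₁) (v i₂)
  ▹-identity v i₁ = solve 3 (λ x y z → 𝟎 :* x :+ 𝟏 :* y :+ 𝟎 :* z := y) refl (v i₀) (v i₁) (v i₂)
  ▹-identity v i₂ = solve 3 (λ x y z → 𝟎 :* x :+ 𝟎 :* y :+ 𝟏 :* z := z) refl (v i₀) (v i₁) (v i₂)

  ▹-inverse : ∀ {A B} → (B · A) ≈ identity → ∀ v → (B ▹ (A ▹ v)) ≗ v
  ▹-inverse {A} {B} BA≈I v i =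
    trans (▹-∘ B A v i) (trans (sum3-cong (λ k → cong (_* v k) (BA≈I i k))) (▹-identity v i))

  ▹-lin : ∀ A a u b w → (A ▹ lin a u b w) ≗ lin a (A ▹ u) b (A ▹ w)
  ▹-lin A a u b w i = solve 11 (λ r₀ r₁ r₂ a u₀ u₁ u₂ b w₀ w₁ w₂ →
      Σₑ (λ k → vecₑ r₀ r₁ r₂ k :* (a :* vecₑ u₀ u₁ u₂ k :+ b :* vecₑ w₀ w₁ w₂ k))
    := a :* Σₑ (λ k → vecₑ r₀ r₁ r₂ k :* vecₑ u₀ u₁ u₂ k) :+ b :* Σₑ (λ k → vecₑ r₀ r₁ r₂ k :* vecₑ w₀ w₁ w₂ k))
    refl (A i i₀) (A i i₁) (A i i₂) a (u i₀) (u i₁) (u i₂) b (w i₀) (w i₁) (w i₂)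

  ▹-scale : ∀ A c v → (A ▹ (λ k → c * v k)) ≗ (λ i → c * (A ▹ v) i)
  ▹-scale A c v i = solve 7 (λ r₀ r₁ r₂ c v₀ v₁ v₂ →
      Σₑ (λ k → vecₑ r₀ r₁ r₂ k :* (c :* vecₑ v₀ v₁ v₂ k)) := c :* Σₑ (λ k → vecₑ r₀ r₁ r₂ k :* vecₑ v₀ v₁ v₂ k))
    refl (A i i₀) (A i i₁) (A i i₂) c (v i₀) (v i₁) (v i₂)

  ▹-zero : ∀ A {v} → IsZeroV v → IsZeroV (A ▹ v)
  ▹-zero A {v} v≡0 i = trans (▹-cong A v≡0 i) (trans (sum3-cong (λ k → zeroʳ (A i k))) zeros)
    where
    zeros : sum3 (λ _ → 0#) ≡ 0#
    zeros = solve 0 (𝟎 :+ 𝟎 :+ 𝟎 := 𝟎) refl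

  ▹-reflects-zero : ∀ {A B} → (B · A) ≈ identity → ∀ {v} → IsZeroV (A ▹ v) → IsZeroV v
  ▹-reflects-zero {A} {B} BA≈I {v} Av≡0 i = trans (sym (▹-inverse {A} {B} BA≈I v i)) (▹-zero B Av≡0 i)

  act-⊕ : ∀ A M N → act A (M ⊕ N) ≈ (act A M ⊕ act A N)
  act-⊕ A M N i j = solve 24 (λ r₀ r₁ r₂ s₀ s₁ s₂ m₀₀ m₀₁ m₀₂ m₁₀ m₁₁ m₁₂ m₂₀ m₂₁ m₂₂ n₀₀ n₀₁ n₀₂ n₁₀ n₁₁ n₁₂ n₂₀ n₂₁ n₂₂ →
      let r = vecₑ r₀ r₁ r₂ ; s = vecₑ s₀ s₁ s₂
          m = matₑ m₀₀ m₀₁ m₀₂ m₁₀ m₁₁ m₁₂ m₂₀ m₂₁ m₂₂ ; n = matₑ n₀₀ n₀₁ n₀₂ n₁₀ n₁₁ n₁₂ n₂₀ n₂₁ n₂₂ in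
      Σₑ (λ k → Σₑ (λ l → r l :* (m l k :+ n l k)) :* s k)
    := Σₑ (λ k → Σₑ (λ l → r l :* m l k) :* s k) :+ Σₑ (λ k → Σₑ (λ l → r l :* n l k) :* s k))
    refl (A i i₀) (A i i₁) (A i i₂) (A j i₀) (A j i₁) (A j i₂)
         (M i₀ i₀) (M i₀ i₁) (M i₀ i₂) (M i₁ i₀) (M i₁ i₁) (M i₁ i₂) (M i₂ i₀) (M i₂ i₁) (M i₂ i₂)
         (N i₀ i₀) (N i₀ i₁) (N i₀ i₂) (N i₁ i₀) (N i₁ i₁) (N i₁ i₂) (N i₂ i₀) (N i₂ i₁) (N i₂ i₂)

  act-⊙ : ∀ A c M → act A (c ⊙ M) ≈ (c ⊙ act A M)
  act-⊙ A c M i j = solve 16 (λ r₀ r₁ r₂ s₀ s₁ s₂ c m₀₀ m₀₁ m₀₂ m₁₀ m₁₁ m₁₂ m₂₀ m₂₁ m₂₂ →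
      let r = vecₑ r₀ r₁ r₂ ; s = vecₑ s₀ s₁ s₂ ; m = matₑ m₀₀ m₀₁ m₀₂ m₁₀ m₁₁ m₁₂ m₂₀ m₂₁ m₂₂ in
      Σₑ (λ k → Σₑ (λ l → r l :* (c :* m l k)) :* s k) := c :* Σₑ (λ k → Σₑ (λ l → r l :* m l k) :* s k))
    refl (A i i₀) (A i i₁) (A i i₂) (A j i₀) (A j i₁) (A j i₂) c
         (M i₀ i₀) (M i₀ i₁) (M i₀ i₂) (M i₁ i₀) (M i₁ i₁) (M i₁ i₂) (M i₂ i₀) (M i₂ i₁) (M i₂ i₂)

  act-outer : ∀ A v → act A (outer v) ≈ outer (A ▹ v)
  act-outer A v i j = solve 9 (λ r₀ r₁ r₂ s₀ s₁ s₂ v₀ v₁ v₂ →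
      let r = vecₑ r₀ r₁ r₂ ; s = vecₑ s₀ s₁ s₂ ; v = vecₑ v₀ v₁ v₂ in
      Σₑ (λ k → Σₑ (λ l → r l :* (v l :* v k)) :* s k) := Σₑ (λ k → r k :* v k) :* Σₑ (λ k → s k :* v k))
    refl (A i i₀) (A i i₁) (A i i₂) (A j i₀) (A j i₁) (A j i₂) (v i₀) (v i₁) (v i₂)

  act-sym-product : ∀ A u w → act A (sym-product u w) ≈ sym-product (A ▹ u) (A ▹ w)
  act-sym-product A u w i j = solve 12 (λ r₀ r₁ r₂ s₀ s₁ s₂ u₀ u₁ u₂ w₀ w₁ w₂ →
      let r = vecₑ r₀ r₁ r₂ ; s = vecₑ s₀ s₁ s₂ ; u = vecₑ u₀ u₁ u₂ ; w = vecₑ w₀ w₁ w₂ in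
      Σₑ (λ k → Σₑ (λ l → r l :* (u l :* w k :+ w l :* u k)) :* s k)
    := Σₑ (λ k → r k :* u k) :* Σₑ (λ k → s k :* w k) :+ Σₑ (λ k → r k :* w k) :* Σₑ (λ k → s k :* u k))
    refl (A i i₀) (A i i₁) (A i i₂) (A j i₀) (A j i₁) (A j i₂) (u i₀) (u i₁) (u i₂) (w i₀) (w i₁) (w i₂)

  act-zero : ∀ A {M} → IsZero M → IsZero (act A M)
  act-zero A {M} M≡0 i j = begin
    act A M i j         ≡⟨ act-cong (≈-refl {A}) M≈0M i j ⟩
    act A (0# ⊙ M) i j  ≡⟨ act-⊙ A 0# M i j ⟩
    0# * act A M i j    ≡⟨ zeroˡ _ ⟩
    0#                  ∎
    where
    open ≡-Reasoning
    M≈0M : M ≈ (0# ⊙ M)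
    M≈0M i j = trans (M≡0 i j) (sym (zeroˡ (M i j)))

  minor-cong : ∀ {M N} → M ≈ N → ∀ i j k l → minor2 M i j k l ≡ minor2 N i j k l
  minor-cong M≈N i j k l =
    cong₂ (λ a b → a + - b) (cong₂ _*_ (M≈N i k) (M≈N j l)) (cong₂ _*_ (M≈N i l) (M≈N j k))

  det-cong : ∀ {M N} → M ≈ N → det M ≡ det N
  det-cong M≈N = cong₂ _+_ (cong₂ _+_ (cong₂ _*_ (M≈N i₀ i₀) (minor-cong M≈N i₁ i₂ i₁ i₂))
                                      (cong₂ _*_ (M≈N i₀ i₁) (cong -_ (minor-cong M≈N i₁ i₂ i₀ i₂))))
                           (cong₂ _*_ (M≈N i₀ i₂) (minor-cong M≈N i₁ i₂ i₀ i₁))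

  det-· : ∀ A B → det (A · B) ≡ det A * det B
  det-· A B = solve 18 (λ a₀₀ a₀₁ a₀₂ a₁₀ a₁₁ a₁₂ a₂₀ a₂₁ a₂₂ b₀₀ b₀₁ b₀₂ b₁₀ b₁₁ b₁₂ b₂₀ b₂₁ b₂₂ →
      let a = matₑ a₀₀ a₀₁ a₀₂ a₁₀ a₁₁ a₁₂ a₂₀ a₂₁ a₂₂ ; b = matₑ b₀₀ b₀₁ b₀₂ b₁₀ b₁₁ b₁₂ b₂₀ b₂₁ b₂₂ in
      detₑ (a ·ₑ b) := detₑ a :* detₑ b)
    refl (A i₀ i₀) (A i₀ i₁) (A i₀ i₂) (A i₁ i₀) (A i₁ i₁) (A i₁ i₂) (A i₂ i₀) (A i₂ i₁) (A i₂ i₂)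
         (B i₀ i₀) (B i₀ i₁) (B i₀ i₂) (B i₁ i₀) (B i₁ i₁) (B i₁ i₂) (B i₂ i₀) (B i₂ i₁) (B i₂ i₂)

  det-transpose : ∀ A → det (transpose A) ≡ det A
  det-transpose A = solve 9 (λ a₀₀ a₀₁ a₀₂ a₁₀ a₁₁ a₁₂ a₂₀ a₂₁ a₂₂ →
      let a = matₑ a₀₀ a₀₁ a₀₂ a₁₀ a₁₁ a₁₂ a₂₀ a₂₁ a₂₂ in detₑ (transposeₑ a) := detₑ a)
    refl (A i₀ i₀) (A i₀ i₁) (A i₀ i₂) (A i₁ i₀) (A i₁ i₁) (A i₁ i₂) (A i₂ i₀) (A i₂ i₁) (A i₂ i₂)

  det-act : ∀ A M → det (act A M) ≡ det A * det M * det A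
  det-act A M = begin
    det ((A · M) · transpose A)        ≡⟨ det-· (A · M) (transpose A) ⟩
    det (A · M) * det (transpose A)    ≡⟨ cong₂ _*_ (det-· A M) (det-transpose A) ⟩
    det A * det M * det A              ∎
    where open ≡-Reasoning

  cauchy-binet : ∀ A B i j k l → minor2 (A · B) i j k l ≡
      minor2 A i j i₀ i₁ * minor2 B i₀ i₁ k l + minor2 A i j i₀ i₂ * minor2 B i₀ i₂ k l
                                              + minor2 A i j i₁ i₂ * minor2 B i₁ i₂ k l
  cauchy-binet A B i j k l = solve 12 (λ p₀ p₁ p₂ q₀ q₁ q₂ x₀ x₁ x₂ y₀ y₁ y₂ →
      let p = vecₑ p₀ p₁ p₂ ; q = vecₑ q₀ q₁ q₂ ; x = vecₑ x₀ x₁ x₂ ; y = vecₑ y₀ y₁ y₂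
          pq : Fin 3 → Fin 3 → Polynomial 12
          pq m n = p m :* q n :+ :- (p n :* q m)
          xy : Fin 3 → Fin 3 → Polynomial 12
          xy m n = x m :* y n :+ :- (y m :* x n) in
      Σₑ (λ m → p m :* x m) :* Σₑ (λ m → q m :* y m) :+ :- (Σₑ (λ m → p m :* y m) :* Σₑ (λ m → q m :* x m))
    := pq i₀ i₁ :* xy i₀ i₁ :+ pq i₀ i₂ :* xy i₀ i₂ :+ pq i₁ i₂ :* xy i₁ i₂)
    refl (A i i₀) (A i i₁) (A i i₂) (A j i₀) (A j i₁) (A j i₂)
         (B i₀ k) (B i₁ k) (B i₂ k) (B i₀ l) (B i₁ l) (B i₂ l)

  MinorsVanish : Mat → Set
  MinorsVanish M = ∀ i j k l → minor2 M i j k l ≡ 0#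

  private
    combination-zero : ∀ a b c {x y z} → x ≡ 0# → y ≡ 0# → z ≡ 0# → a * x + b * y + c * z ≡ 0#
    combination-zero a b c refl refl refl = solve 3 (λ a b c → a :* 𝟎 :+ b :* 𝟎 :+ c :* 𝟎 := 𝟎) refl a b c

  minorsVanish-·ʳ : ∀ A {B} → MinorsVanish B → MinorsVanish (A · B)
  minorsVanish-·ʳ A {B} B-rank≤1 i j k l = trans (cauchy-binet A B i j k l)
    (combination-zero _ _ _ (B-rank≤1 i₀ i₁ k l) (B-rank≤1 i₀ i₂ k l) (B-rank≤1 i₁ i₂ k l))

  minorsVanish-·ˡ : ∀ {A} B → MinorsVanish A → MinorsVanish (A · B)
  minorsVanish-·ˡ {A} B A-rank≤1 i j k l = trans (cauchy-binet A B i j k l)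
    (trans (cong₂ _+_ (cong₂ _+_ (*-comm _ _) (*-comm _ _)) (*-comm _ _))
           (combination-zero _ _ _ (A-rank≤1 i j i₀ i₁) (A-rank≤1 i j i₀ i₂) (A-rank≤1 i j i₁ i₂)))

  minorsVanish-act : ∀ A {M} → MinorsVanish M → MinorsVanish (act A M)
  minorsVanish-act A {M} M-rank≤1 = minorsVanish-·ˡ (transpose A) (minorsVanish-·ʳ A M-rank≤1)

  act-pencil : ∀ A a M b N → act A ((a ⊙ M) ⊕ (b ⊙ N)) ≈ ((a ⊙ act A M) ⊕ (b ⊙ act A N))
  act-pencil A a M b N i j =
    trans (act-⊕ A (a ⊙ M) (b ⊙ N) i j) (cong₂ _+_ (act-⊙ A a M i j) (act-⊙ A b N i j))

  conicPlanePoint : Carrier → Carrier → Carrier → Vec3 → Vec3 → Mat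
  conicPlanePoint a b c u w = (a ⊙ outer u) ⊕ ((b ⊙ outer w) ⊕ (c ⊙ sym-product u w))

  act-conic : ∀ A a b c u w → act A (conicPlanePoint a b c u w) ≈ conicPlanePoint a b c (A ▹ u) (A ▹ w)
  act-conic A a b c u w i j = begin
    act A ((a ⊙ outer u) ⊕ ((b ⊙ outer w) ⊕ (c ⊙ sym-product u w))) i j
      ≡⟨ act-⊕ A (a ⊙ outer u) ((b ⊙ outer w) ⊕ (c ⊙ sym-product u w)) i j ⟩
    act A (a ⊙ outer u) i j + act A ((b ⊙ outer w) ⊕ (c ⊙ sym-product u w)) i j
      ≡⟨ cong (act A (a ⊙ outer u) i j +_) (act-pencil A b (outer w) c (sym-product u w) i j) ⟩
    act A (a ⊙ outer u) i j + (b * act A (outer w) i j + c * act A (sym-product u w) i j)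
      ≡⟨ cong₂ _+_ (trans (act-⊙ A a (outer u) i j) (cong (a *_) (act-outer A u i j)))
                   (cong₂ _+_ (cong (b *_) (act-outer A w i j)) (cong (c *_) (act-sym-product A u w i j))) ⟩
    a * outer (A ▹ u) i j + (b * outer (A ▹ w) i j + c * sym-product (A ▹ u) (A ▹ w) i j)
      ∎
    where open ≡-Reasoning

  ∼-act : ∀ C {M N} → M ∼ N → act C M ∼ act C N
  ∼-act C {M} {N} (c , c≢0 , M≈cN) =
    c , c≢0 , λ i j → trans (act-cong (≈-refl {C}) M≈cN i j) (act-⊙ C c N i j)

module Invariance (F : FiniteField) where
  open import Data.List.Base using (List; length; map)
  open import Data.List.Properties using (length-map)
  open import Data.List.Relation.Unary.All as All using (All)
  import Data.List.Relation.Unary.All.Properties as AllP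
  open import Data.List.Relation.Unary.Any as Any using (Any)
  import Data.List.Relation.Unary.Any.Properties as AnyP
  open import Data.List.Relation.Unary.AllPairs as AllPairs using (AllPairs)
  import Data.List.Relation.Unary.AllPairs.Properties as AllPairsP
  open import Data.Product.Base using (Σ; _,_; proj₁; proj₂; _×_)
  open import Relation.Nullary using (¬_)
  open import Relation.Binary.PropositionalEquality
  open FiniteField F
  open Geometry F renaming (sym to sym-product)
  open FieldFacts F
  open MatrixAlgebra F

  rank1-cong : ∀ {M N} → M ≈ N → Rank1 M → Rank1 N
  rank1-cong M≈N (M≢0 , M-minors) =
    (λ N≡0 → M≢0 (λ i j → trans (M≈N i j) (N≡0 i j))) ,
    (λ i j k l → trans (sym (minor-cong M≈N i j k l)) (M-minors i j k l))

  rank2-cong : ∀ {M N} → M ≈ N → Rank2 M → Rank2 N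
  rank2-cong M≈N (M-minors≢0 , detM≡0) =
    (λ N-minors → M-minors≢0 (λ i j k l → trans (minor-cong M≈N i j k l) (N-minors i j k l))) ,
    trans (sym (det-cong M≈N)) detM≡0

  rank3-cong : ∀ {M N} → M ≈ N → Rank3 M → Rank3 N
  rank3-cong M≈N detM≢0 detN≡0 = detM≢0 (trans (det-cong M≈N) detN≡0)

  exterior-cong : ∀ {M N} → M ≈ N → Exterior M → Exterior N
  exterior-cong {M} {N} M≈N (rank2 , u , w , indep , (a , b , c , M≈abc) , (s , t , v≢0 , tangent)) =
    rank2-cong M≈N rank2 , u , w , indep , (a , b , c , ≈-trans (≈-sym M≈N) M≈abc) ,
    (s , t , v≢0 , λ x y p≢0 (a′ , b′ , on-line) →
       tangent x y p≢0 (a′ , b′ , λ i j → trans (on-line i j)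
         (cong (λ z → a′ * outer (lin s u t w) i j + b′ * z) (sym (M≈N i j)))))

  interior-cong : ∀ {M N} → M ≈ N → Interior M → Interior N
  interior-cong M≈N (rank2 , ¬ext) = rank2-cong M≈N rank2 , (λ ext → ¬ext (exterior-cong (≈-sym M≈N) ext))

  InStandardPlane : Mat → Set
  InStandardPlane X = Σ Carrier λ α → Σ Carrier λ β → Σ Carrier λ γ → X ≈ Σ3-matrix α β γ

  Enumerates : (Mat → Set) → List Mat → Set
  Enumerates P L =
    All (λ X → InStandardPlane X × ¬ IsZero X × P X) L ×
    AllPairs (λ X Y → ¬ (X ∼ Y)) L ×
    (∀ α β γ → ¬ IsZero (Σ3-matrix α β γ) → P (Σ3-matrix α β γ) → Any (Σ3-matrix α β γ ∼_) L)

  module LeftInvertible {A B : Mat} (BA≈I : (B · A) ≈ identity) where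

    act-injective : ∀ {M N} → act A M ≈ act A N → M ≈ N
    act-injective {M} {N} AM≈AN = ≈-trans (≈-sym (act-inverse {A} {B} BA≈I M))
      (≈-trans (act-cong (≈-refl {B}) AM≈AN) (act-inverse {A} {B} BA≈I N))

    nonzero-act : ∀ {M} → ¬ IsZero M → ¬ IsZero (act A M)
    nonzero-act {M} M≢0 AM≡0 = M≢0 (λ i j → trans (sym (act-inverse {A} {B} BA≈I M i j)) (act-zero B AM≡0 i j))

    minorsVanish-reflect : ∀ {M} → MinorsVanish (act A M) → MinorsVanish M
    minorsVanish-reflect {M} AM-minors i j k l =
      trans (sym (minor-cong (act-inverse {A} {B} BA≈I M) i j k l)) (minorsVanish-act B AM-minors i j k l)

    det-zero-act : ∀ C M → det M ≡ 0# → det (act C M) ≡ 0#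
    det-zero-act C M detM≡0 = trans (det-act C M) (trans (cong (λ d → det C * d * det C) detM≡0)
      (solve 1 (λ d → d :* 𝟎 :* d := 𝟎) refl (det C)))

    det-zero-reflect : ∀ M → det (act A M) ≡ 0# → det M ≡ 0#
    det-zero-reflect M detAM≡0 =
      trans (sym (det-cong (act-inverse {A} {B} BA≈I M))) (det-zero-act B (act A M) detAM≡0)

    rank1-act : ∀ M → Rank1 M → Rank1 (act A M)
    rank1-act M (M≢0 , M-minors) = nonzero-act M≢0 , minorsVanish-act A M-minors

    rank1-reflect : ∀ M → Rank1 (act A M) → Rank1 M
    rank1-reflect M (AM≢0 , AM-minors) = (λ M≡0 → AM≢0 (act-zero A M≡0)) , minorsVanish-reflect AM-minors

    rank2-act : ∀ M → Rank2 M → Rank2 (act A M)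
    rank2-act M (M-minors≢0 , detM≡0) =
      (λ AM-minors → M-minors≢0 (minorsVanish-reflect AM-minors)) , det-zero-act A M detM≡0

    rank2-reflect : ∀ M → Rank2 (act A M) → Rank2 M
    rank2-reflect M (AM-minors≢0 , detAM≡0) =
      (λ M-minors → AM-minors≢0 (minorsVanish-act A M-minors)) , det-zero-reflect M detAM≡0

    rank3-act : ∀ M → Rank3 M → Rank3 (act A M)
    rank3-act M detM≢0 detAM≡0 = detM≢0 (det-zero-reflect M detAM≡0)

    rank3-reflect : ∀ M → Rank3 (act A M) → Rank3 M
    rank3-reflect M detAM≢0 detM≡0 = detAM≢0 (det-zero-act A M detM≡0)

    ∼-reflect : ∀ {M N} → act A M ∼ act A N → M ∼ N
    ∼-reflect {M} {N} AM∼AN = pull-back (∼-act B AM∼AN)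
      where
      pull-back : act B (act A M) ∼ act B (act A N) → M ∼ N
      pull-back (c , c≢0 , BAM≈cBAN) = c , c≢0 , λ i j →
        trans (sym (act-inverse {A} {B} BA≈I M i j))
              (trans (BAM≈cBAN i j) (cong (c *_) (act-inverse {A} {B} BA≈I N i j)))

    -- A maps the conic through u, w to the conic through A u, A w, and
    -- tangent lines to tangent lines; so exterior points to exterior points
    exterior-act : ∀ X → Exterior X → Exterior (act A X)
    exterior-act X (rank2 , u , w , indep , (a , b , c , X≈abc) , (s , t , v≢0 , tangent)) =
      rank2-act X rank2 , A ▹ u , A ▹ w , indep′ ,
      (a , b , c , ≈-trans (act-cong (≈-refl {A}) X≈abc) (act-conic A a b c u w)) ,
      (s , t , image-nonzero v≢0 , tangent′)
      where
      lin-image : ∀ x y → lin x (A ▹ u) y (A ▹ w) ≗ (A ▹ lin x u y w)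
      lin-image x y i = sym (▹-lin A x u y w i)

      image-nonzero : ∀ {x y} → ¬ IsZeroV (lin x u y w) → ¬ IsZeroV (lin x (A ▹ u) y (A ▹ w))
      image-nonzero {x} {y} p≢0 Ap≡0 = p≢0 (▹-reflects-zero {A} {B} BA≈I (λ i → trans (sym (lin-image x y i)) (Ap≡0 i)))

      indep′ : LinIndep (A ▹ u) (A ▹ w)
      indep′ x y Ap≡0 = indep x y (▹-reflects-zero {A} {B} BA≈I (λ i → trans (sym (lin-image x y i)) (Ap≡0 i)))

      tangent′ : ∀ x y → ¬ IsZeroV (lin x (A ▹ u) y (A ▹ w)) →
        (Σ Carrier λ a′ → Σ Carrier λ b′ →
           outer (lin x (A ▹ u) y (A ▹ w)) ≈ ((a′ ⊙ outer (lin s (A ▹ u) t (A ▹ w))) ⊕ (b′ ⊙ act A X))) →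
        ProportionalV (lin x (A ▹ u) y (A ▹ w)) (lin s (A ▹ u) t (A ▹ w))
      tangent′ x y Ap≢0 (a′ , b′ , on-line′) = l , proportional′
        where
        p v : Vec3
        p = lin x u y w
        v = lin s u t w

        -- pulling the line through A v (A v)ᵀ and A X Aᵀ back along A
        on-line : outer p ≈ ((a′ ⊙ outer v) ⊕ (b′ ⊙ X))
        on-line = act-injective λ i j → begin
          act A (outer p) i j                                    ≡⟨ act-outer A p i j ⟩
          (A ▹ p) i * (A ▹ p) j                                  ≡⟨ cong₂ _*_ (lin-image x y i) (lin-image x y j) ⟨
          outer (lin x (A ▹ u) y (A ▹ w)) i j                    ≡⟨ on-line′ i j ⟩
          a′ * outer (lin s (A ▹ u) t (A ▹ w)) i j + b′ * act A X i j
            ≡⟨ cong (λ z → a′ * z + b′ * act A X i j)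
                    (trans (cong₂ _*_ (lin-image s t i) (lin-image s t j)) (sym (act-outer A v i j))) ⟩
          a′ * act A (outer v) i j + b′ * act A X i j            ≡⟨ act-pencil A a′ (outer v) b′ X i j ⟨
          act A ((a′ ⊙ outer v) ⊕ (b′ ⊙ X)) i j                  ∎
          where open ≡-Reasoning

        p∝v : ProportionalV p v
        p∝v = tangent x y (λ p≡0 → Ap≢0 (λ i → trans (lin-image x y i) (▹-zero A p≡0 i))) (a′ , b′ , on-line)

        l : Carrier
        l = proj₁ p∝v

        proportional′ : ∀ i → lin x (A ▹ u) y (A ▹ w) i ≡ l * lin s (A ▹ u) t (A ▹ w) i
        proportional′ i = begin
          lin x (A ▹ u) y (A ▹ w) i     ≡⟨ lin-image x y i ⟩
          (A ▹ p) i                     ≡⟨ ▹-cong A (proj₂ p∝v) i ⟩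
          (A ▹ (λ k → l * v k)) i       ≡⟨ ▹-scale A l v i ⟩
          l * (A ▹ v) i                 ≡⟨ cong (l *_) (lin-image s t i) ⟨
          l * lin s (A ▹ u) t (A ▹ w) i ∎
          where open ≡-Reasoning

  module Invertible {A B : Mat} (BA≈I : (B · A) ≈ identity) (AB≈I : (A · B) ≈ identity) where
    open LeftInvertible {A} {B} BA≈I public
    private module Inverse = LeftInvertible {B} {A} AB≈I

    exterior-reflect : ∀ X → Exterior (act A X) → Exterior X
    exterior-reflect X ext = exterior-cong (act-inverse {A} {B} BA≈I X) (Inverse.exterior-act (act A X) ext)

    interior-act : ∀ X → Interior X → Interior (act A X)
    interior-act X (rank2 , ¬ext) = rank2-act X rank2 , (λ ext → ¬ext (exterior-reflect X ext))

    interior-reflect : ∀ X → Interior (act A X) → Interior X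
    interior-reflect X (rank2 , ¬ext) = rank2-reflect X rank2 , (λ ext → ¬ext (exterior-act X ext))

    numPoints-transfer : ∀ (P : Mat → Set) → (∀ X → P X → P (act A X)) → (∀ X → P (act A X) → P X) →
      (∀ {M N} → M ≈ N → P M → P N) → ∀ {L n} → length L ≡ n → Enumerates P L → NumPoints A P n
    numPoints-transfer P P-act P-reflect P-cong {L} length≡ (points , distinct , complete) =
      map (act A) L , trans (length-map (act A) L) length≡ ,
      AllP.map⁺ (All.map image points) ,
      AllPairsP.map⁺ (AllPairs.map (λ X≁Y AX∼AY → X≁Y (∼-reflect AX∼AY)) distinct) ,
      complete′
      where
      image : ∀ {X} → InStandardPlane X × ¬ IsZero X × P X → InPlane A (act A X) × ¬ IsZero (act A X) × P (act A X)
      image {X} ((α , β , γ , X≈S) , X≢0 , PX) = (α , β , γ , act-cong (≈-refl {A}) X≈S) , nonzero-act X≢0 , P-act X PX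

      complete′ : ∀ M → InPlane A M → ¬ IsZero M → P M → Any (λ N → M ∼ N) (map (act A) L)
      complete′ M (α , β , γ , M≈AS) M≢0 PM =
        AnyP.map⁺ (Any.map (λ {Y} S∼Y → M∼ {Y} (∼-act A S∼Y)) (complete α β γ S≢0 (P-reflect (Σ3-matrix α β γ) (P-cong M≈AS PM))))
        where
        S≢0 : ¬ IsZero (Σ3-matrix α β γ)
        S≢0 S≡0 = M≢0 (λ i j → trans (M≈AS i j) (act-zero A S≡0 i j))
        M∼ : ∀ {Y} → act A (Σ3-matrix α β γ) ∼ act A Y → M ∼ act A Y
        M∼ (c , c≢0 , AS≈cAY) = c , c≢0 , λ i j → trans (M≈AS i j) (AS≈cAY i j)

module StandardPlane (F : FiniteField) where
  open import Data.Nat.Base using (ℕ)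
  open import Data.Fin.Base using (Fin)
  open import Data.Product.Base using (Σ; _,_; proj₁; proj₂; _×_)
  open import Data.Sum.Base using (_⊎_; inj₁; inj₂)
  open import Data.Empty using (⊥; ⊥-elim)
  open import Relation.Nullary using (¬_; Dec; yes; no)
  open import Relation.Binary.PropositionalEquality
  open FiniteField F
  open Geometry F renaming (sym to sym-product)
  open FieldFacts F
  open MatrixAlgebra F

  S : Carrier → Carrier → Carrier → Mat
  S = Σ3-matrix

  e₀ e₁ e₂ : Vec3
  e₀ i₀ = 1#
  e₀ _  = 0#
  e₁ i₁ = 1#
  e₁ _  = 0#
  e₂ i₂ = 1#
  e₂ _  = 0#

  module SymbolicPlane {n : ℕ} where
    open Symbolic {n}
    Sₑ : (α β γ : Polynomial n) → Fin 3 → Fin 3 → Polynomial n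
    Sₑ α β γ = matₑ α 𝟎 γ 𝟎 β 𝟎 γ 𝟎 𝟎

    basisₑ : Fin 3 → Fin 3 → Polynomial n
    basisₑ = matₑ 𝟏 𝟎 𝟎 𝟎 𝟏 𝟎 𝟎 𝟎 𝟏

    conicₑ : (a b c : Polynomial n) (u w : Fin 3 → Polynomial n) → Fin 3 → Fin 3 → Polynomial n
    conicₑ a b c u w i j = a :* (u i :* u j) :+ (b :* (w i :* w j) :+ c :* (u i :* w j :+ w i :* u j))

  open Symbolic
  open SymbolicPlane

  det-S : ∀ α β γ → det (S α β γ) ≡ - (β * (γ * γ))
  det-S = solve 3 (λ α β γ → detₑ (Sₑ α β γ) := :- (β :* (γ :* γ))) refl

  minor-S₀₁ : ∀ α β γ → minor2 (S α β γ) i₀ i₁ i₀ i₁ ≡ α * β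
  minor-S₀₁ = solve 3 (λ α β γ → minorₑ (Sₑ α β γ) i₀ i₁ i₀ i₁ := α :* β) refl

  minor-S₀₂ : ∀ α β γ → minor2 (S α β γ) i₀ i₂ i₀ i₂ ≡ - (γ * γ)
  minor-S₀₂ = solve 3 (λ α β γ → minorₑ (Sₑ α β γ) i₀ i₂ i₀ i₂ := :- (γ :* γ)) refl

  S-on-conic₀₂ : ∀ α γ → S α 0# γ ≈ conicPlanePoint α 0# γ e₀ e₂
  S-on-conic₀₂ α γ i j = entry i j
    where
    entry : ∀ i j → S α 0# γ i j ≡ conicPlanePoint α 0# γ e₀ e₂ i j
    entry i@i₀ j@i₀ = solve 2 (λ α γ → Sₑ α 𝟎 γ i j := conicₑ α 𝟎 γ (basisₑ i₀) (basisₑ i₂) i j) refl α γ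
    entry i@i₀ j@i₁ = solve 2 (λ α γ → Sₑ α 𝟎 γ i j := conicₑ α 𝟎 γ (basisₑ i₀) (basisₑ i₂) i j) refl α γ
    entry i@i₀ j@i₂ = solve 2 (λ α γ → Sₑ α 𝟎 γ i j := conicₑ α 𝟎 γ (basisₑ i₀) (basisₑ i₂) i j) refl α γ
    entry i@i₁ j@i₀ = solve 2 (λ α γ → Sₑ α 𝟎 γ i j := conicₑ α 𝟎 γ (basisₑ i₀) (basisₑ i₂) i j) refl α γ
    entry i@i₁ j@i₁ = solve 2 (λ α γ → Sₑ α 𝟎 γ i j := conicₑ α 𝟎 γ (basisₑ i₀) (basisₑ i₂) i j) refl α γ
    entry i@i₁ j@i₂ = solve 2 (λ α γ → Sₑ α 𝟎 γ i j := conicₑ α 𝟎 γ (basisₑ i₀) (basisₑ i₂) i j) refl α γ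
    entry i@i₂ j@i₀ = solve 2 (λ α γ → Sₑ α 𝟎 γ i j := conicₑ α 𝟎 γ (basisₑ i₀) (basisₑ i₂) i j) refl α γ
    entry i@i₂ j@i₁ = solve 2 (λ α γ → Sₑ α 𝟎 γ i j := conicₑ α 𝟎 γ (basisₑ i₀) (basisₑ i₂) i j) refl α γ
    entry i@i₂ j@i₂ = solve 2 (λ α γ → Sₑ α 𝟎 γ i j := conicₑ α 𝟎 γ (basisₑ i₀) (basisₑ i₂) i j) refl α γ

  S-on-conic₀₁ : ∀ α β → S α β 0# ≈ conicPlanePoint α β 0# e₀ e₁
  S-on-conic₀₁ α β i j = entry i j
    where
    entry : ∀ i j → S α β 0# i j ≡ conicPlanePoint α β 0# e₀ e₁ i j
    entry i@i₀ j@i₀ = solve 2 (λ α β → Sₑ α β 𝟎 i j := conicₑ α β 𝟎 (basisₑ i₀) (basisₑ i₁) i j) refl α β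
    entry i@i₀ j@i₁ = solve 2 (λ α β → Sₑ α β 𝟎 i j := conicₑ α β 𝟎 (basisₑ i₀) (basisₑ i₁) i j) refl α β
    entry i@i₀ j@i₂ = solve 2 (λ α β → Sₑ α β 𝟎 i j := conicₑ α β 𝟎 (basisₑ i₀) (basisₑ i₁) i j) refl α β
    entry i@i₁ j@i₀ = solve 2 (λ α β → Sₑ α β 𝟎 i j := conicₑ α β 𝟎 (basisₑ i₀) (basisₑ i₁) i j) refl α β
    entry i@i₁ j@i₁ = solve 2 (λ α β → Sₑ α β 𝟎 i j := conicₑ α β 𝟎 (basisₑ i₀) (basisₑ i₁) i j) refl α β
    entry i@i₁ j@i₂ = solve 2 (λ α β → Sₑ α β 𝟎 i j := conicₑ α β 𝟎 (basisₑ i₀) (basisₑ i₁) i j) refl α β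
    entry i@i₂ j@i₀ = solve 2 (λ α β → Sₑ α β 𝟎 i j := conicₑ α β 𝟎 (basisₑ i₀) (basisₑ i₁) i j) refl α β
    entry i@i₂ j@i₁ = solve 2 (λ α β → Sₑ α β 𝟎 i j := conicₑ α β 𝟎 (basisₑ i₀) (basisₑ i₁) i j) refl α β
    entry i@i₂ j@i₂ = solve 2 (λ α β → Sₑ α β 𝟎 i j := conicₑ α β 𝟎 (basisₑ i₀) (basisₑ i₁) i j) refl α β

  minorsVanish-conicPoint₁ : ∀ a u w → MinorsVanish (conicPlanePoint a 0# 0# u w)
  minorsVanish-conicPoint₁ a u w i j k l = solve 9 (λ a u₀ u₁ u₂ u₃ w₀ w₁ w₂ w₃ →
      let m = λ (p q : Polynomial 9) (x y : Polynomial 9) → a :* (p :* q) :+ (𝟎 :* (x :* y) :+ 𝟎 :* (p :* y :+ x :* q)) in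
      m u₀ u₂ w₀ w₂ :* m u₁ u₃ w₁ w₃ :+ :- (m u₀ u₃ w₀ w₃ :* m u₁ u₂ w₁ w₂) := 𝟎)
    refl a (u i) (u j) (u k) (u l) (w i) (w j) (w k) (w l)

  minorsVanish-conicPoint₂ : ∀ b u w → MinorsVanish (conicPlanePoint 0# b 0# u w)
  minorsVanish-conicPoint₂ b u w i j k l = solve 9 (λ b u₀ u₁ u₂ u₃ w₀ w₁ w₂ w₃ →
      let m = λ (p q : Polynomial 9) (x y : Polynomial 9) → 𝟎 :* (p :* q) :+ (b :* (x :* y) :+ 𝟎 :* (p :* y :+ x :* q)) in
      m u₀ u₂ w₀ w₂ :* m u₁ u₃ w₁ w₃ :+ :- (m u₀ u₃ w₀ w₃ :* m u₁ u₂ w₁ w₂) := 𝟎)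
    refl b (u i) (u j) (u k) (u l) (w i) (w j) (w k) (w l)

  -- S 1 0 0 and S 0 1 0 are the points e₀ e₀ᵀ and e₁ e₁ᵀ of V(F_q)
  rank1-S₁₀₀ : Rank1 (S 1# 0# 0#)
  rank1-S₁₀₀ = (λ S≡0 → 1≢0 (S≡0 i₀ i₀)) ,
    (λ i j k l → trans (minor-cong (S-on-conic₀₁ 1# 0#) i j k l) (minorsVanish-conicPoint₁ 1# e₀ e₁ i j k l))

  rank1-S₀₁₀ : Rank1 (S 0# 1# 0#)
  rank1-S₀₁₀ = (λ S≡0 → 1≢0 (S≡0 i₁ i₁)) ,
    (λ i j k l → trans (minor-cong (S-on-conic₀₁ 0# 1#) i j k l) (minorsVanish-conicPoint₂ 1# e₀ e₁ i j k l))

  private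
    cong₃ : ∀ (f : Carrier → Carrier → Carrier → Carrier) {a b c a′ b′ c′} →
            a ≡ a′ → b ≡ b′ → c ≡ c′ → f a b c ≡ f a′ b′ c′
    cong₃ f refl refl refl = refl

  vec3 : Carrier → Carrier → Carrier → Vec3
  vec3 x y z i₀ = x
  vec3 x y z i₁ = y
  vec3 x y z i₂ = z

  lin-e₀e₁ : ∀ x y → lin x e₀ y e₁ ≗ vec3 x y 0#
  lin-e₀e₁ x y i₀ = solve 2 (λ x y → x :* 𝟏 :+ y :* 𝟎 := x) refl x y
  lin-e₀e₁ x y i₁ = solve 2 (λ x y → x :* 𝟎 :+ y :* 𝟏 := y) refl x y
  lin-e₀e₁ x y i₂ = solve 2 (λ x y → x :* 𝟎 :+ y :* 𝟎 := 𝟎) refl x y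

  lin-e₀e₂ : ∀ x y → lin x e₀ y e₂ ≗ vec3 x 0# y
  lin-e₀e₂ x y i₀ = solve 2 (λ x y → x :* 𝟏 :+ y :* 𝟎 := x) refl x y
  lin-e₀e₂ x y i₁ = solve 2 (λ x y → x :* 𝟎 :+ y :* 𝟎 := 𝟎) refl x y
  lin-e₀e₂ x y i₂ = solve 2 (λ x y → x :* 𝟎 :+ y :* 𝟏 := y) refl x y

  on-line-cong : ∀ {p p′ v v′ M} a′ b′ → p ≗ p′ → v ≗ v′ →
    outer p ≈ ((a′ ⊙ outer v) ⊕ (b′ ⊙ M)) → outer p′ ≈ ((a′ ⊙ outer v′) ⊕ (b′ ⊙ M))
  on-line-cong {M = M} a′ b′ p≗p′ v≗v′ on-line i j =
    trans (cong₂ _*_ (sym (p≗p′ i)) (sym (p≗p′ j)))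
          (trans (on-line i j) (cong (λ z → a′ * z + b′ * M i j) (cong₂ _*_ (v≗v′ i) (v≗v′ j))))

  -- For γ ≠ 0, S α 0 γ is exterior: it lies on the tangent at e₀ e₀ᵀ to
  -- the conic through e₀, e₂.
  exterior-S-α0γ : ∀ α γ → γ ≢ 0# → Exterior (S α 0# γ)
  exterior-S-α0γ α γ γ≢0 =
    (minors≢0 , det≡0) , e₀ , e₂ , independent , (α , 0# , γ , S-on-conic₀₂ α γ) , (1# , 0# , e₀≢0 , tangent)
    where
    minors≢0 : ¬ MinorsVanish (S α 0# γ)
    minors≢0 vanish = γ≢0 (square-zero (neg-zero (trans (sym (minor-S₀₂ α 0# γ)) (vanish i₀ i₂ i₀ i₂))))

    det≡0 : det (S α 0# γ) ≡ 0#
    det≡0 = trans (det-S α 0# γ) (solve 1 (λ γ → :- (𝟎 :* (γ :* γ)) := 𝟎) refl γ)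

    independent : LinIndep e₀ e₂
    independent a b ab≡0 = trans (sym (lin-e₀e₂ a b i₀)) (ab≡0 i₀) , trans (sym (lin-e₀e₂ a b i₂)) (ab≡0 i₂)

    e₀≢0 : ¬ IsZeroV (lin 1# e₀ 0# e₂)
    e₀≢0 e₀≡0 = 1≢0 (trans (sym (lin-e₀e₂ 1# 0# i₀)) (e₀≡0 i₀))

    tangent : ∀ x y → ¬ IsZeroV (lin x e₀ y e₂) →
      (Σ Carrier λ a′ → Σ Carrier λ b′ → outer (lin x e₀ y e₂) ≈ ((a′ ⊙ outer (lin 1# e₀ 0# e₂)) ⊕ (b′ ⊙ S α 0# γ))) →
      ProportionalV (lin x e₀ y e₂) (lin 1# e₀ 0# e₂)
    tangent x y _ (a′ , b′ , on-line) = x , proportional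
      where
      -- the (2,2) entry gives y² = 0
      y≡0 : y ≡ 0#
      y≡0 = square-zero (trans (on-line-cong a′ b′ (lin-e₀e₂ x y) (lin-e₀e₂ 1# 0#) on-line i₂ i₂)
                               (solve 2 (λ a′ b′ → a′ :* (𝟎 :* 𝟎) :+ b′ :* 𝟎 := 𝟎) refl a′ b′))
      proportional : ∀ i → lin x e₀ y e₂ i ≡ x * lin 1# e₀ 0# e₂ i
      proportional i = trans (lin-e₀e₂ x y i) (trans (scaled i) (cong (x *_) (sym (lin-e₀e₂ 1# 0# i))))
        where
        scaled : ∀ i → vec3 x 0# y i ≡ x * vec3 1# 0# 0# i
        scaled i₀ = sym (*-identityʳ x)
        scaled i₁ = sym (zeroʳ x)
        scaled i₂ = trans y≡0 (sym (zeroʳ x))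

  -- For α, β ≠ 0 with - α β = r², S α β 0 is exterior: it lies on the
  -- tangent at v vᵀ, v = r e₀ + β e₁, to the conic through e₀, e₁.
  exterior-S-αβ0 : ∀ α β r → α ≢ 0# → β ≢ 0# → - (α * β) ≡ r * r → Exterior (S α β 0#)
  exterior-S-αβ0 α β r α≢0 β≢0 -αβ≡r² =
    (minors≢0 , det≡0) , e₀ , e₁ , independent , (α , β , 0# , S-on-conic₀₁ α β) , (r , β , v≢0 , tangent)
    where
    minors≢0 : ¬ MinorsVanish (S α β 0#)
    minors≢0 vanish = *-nonzero α≢0 β≢0 (trans (sym (minor-S₀₁ α β 0#)) (vanish i₀ i₁ i₀ i₁))

    det≡0 : det (S α β 0#) ≡ 0#
    det≡0 = trans (det-S α β 0#) (solve 1 (λ β → :- (β :* (𝟎 :* 𝟎)) := 𝟎) refl β)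

    independent : LinIndep e₀ e₁
    independent a b ab≡0 = trans (sym (lin-e₀e₁ a b i₀)) (ab≡0 i₀) , trans (sym (lin-e₀e₁ a b i₁)) (ab≡0 i₁)

    v≢0 : ¬ IsZeroV (lin r e₀ β e₁)
    v≢0 v≡0 = β≢0 (trans (sym (lin-e₀e₁ r β i₁)) (v≡0 i₁))

    tangent : ∀ x y → ¬ IsZeroV (lin x e₀ y e₁) →
      (Σ Carrier λ a′ → Σ Carrier λ b′ → outer (lin x e₀ y e₁) ≈ ((a′ ⊙ outer (lin r e₀ β e₁)) ⊕ (b′ ⊙ S α β 0#))) →
      ProportionalV (lin x e₀ y e₁) (lin r e₀ β e₁)
    tangent x y _ (a′ , b′ , on-line) = y * inv β β≢0 , proportional
      where
      entries : outer (vec3 x y 0#) ≈ ((a′ ⊙ outer (vec3 r β 0#)) ⊕ (b′ ⊙ S α β 0#))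
      entries = on-line-cong a′ b′ (lin-e₀e₁ x y) (lin-e₀e₁ r β) on-line

      -- (β x - r y)² = b′ β (α β + r²) = 0
      open ≡-Reasoning

      βx≡ry : β * x ≡ r * y
      βx≡ry = x∙y⁻¹≈ε⇒x≈y (β * x) (r * y) (square-zero (begin
        (β * x + - (r * y)) * (β * x + - (r * y))
          ≡⟨ solve 4 (λ x y r β → (β :* x :+ :- (r :* y)) :* (β :* x :+ :- (r :* y))
                := β :* β :* (x :* x) :+ :- (r :* β :* (x :* y)) :+ :- (r :* β :* (x :* y)) :+ r :* r :* (y :* y)) refl x y r β ⟩
        β * β * (x * x) + - (r * β * (x * y)) + - (r * β * (x * y)) + r * r * (y * y)
          ≡⟨ cong₃ (λ X₀₀ X₀₁ X₁₁ → β * β * X₀₀ + - (r * β * X₀₁) + - (r * β * X₀₁) + r * r * X₁₁)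
                   (entries i₀ i₀) (entries i₀ i₁) (entries i₁ i₁) ⟩
        β * β * (a′ * (r * r) + b′ * α) + - (r * β * (a′ * (r * β) + b′ * 0#))
          + - (r * β * (a′ * (r * β) + b′ * 0#)) + r * r * (a′ * (β * β) + b′ * β)
          ≡⟨ solve 5 (λ a′ b′ r β α → β :* β :* (a′ :* (r :* r) :+ b′ :* α) :+ :- (r :* β :* (a′ :* (r :* β) :+ b′ :* 𝟎))
                :+ :- (r :* β :* (a′ :* (r :* β) :+ b′ :* 𝟎)) :+ r :* r :* (a′ :* (β :* β) :+ b′ :* β)
                := b′ :* β :* (α :* β :+ r :* r)) refl a′ b′ r β α ⟩
        b′ * β * (α * β + r * r)
          ≡⟨ cong (b′ * β *_) (trans (cong (α * β +_) (sym -αβ≡r²)) (-‿inverseʳ (α * β))) ⟩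
        b′ * β * 0#
          ≡⟨ zeroʳ (b′ * β) ⟩
        0# ∎))

      proportional : ∀ i → lin x e₀ y e₁ i ≡ (y * inv β β≢0) * lin r e₀ β e₁ i
      proportional i = trans (lin-e₀e₁ x y i) (trans (scaled i) (cong (y * inv β β≢0 *_) (sym (lin-e₀e₁ r β i))))
        where
        β⁻¹ : Carrier
        β⁻¹ = inv β β≢0
        scaled : ∀ i → vec3 x y 0# i ≡ (y * β⁻¹) * vec3 r β 0# i
        scaled i₀ = begin
          x                ≡⟨ *-identityʳ x ⟨
          x * 1#           ≡⟨ cong (x *_) (inv-l β β≢0) ⟨
          x * (β⁻¹ * β)    ≡⟨ solve 3 (λ x b i → x :* (i :* b) := i :* (b :* x)) refl x β β⁻¹ ⟩
          β⁻¹ * (β * x)    ≡⟨ cong (β⁻¹ *_) βx≡ry ⟩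
          β⁻¹ * (r * y)    ≡⟨ solve 3 (λ i r y → i :* (r :* y) := (y :* i) :* r) refl β⁻¹ r y ⟩
          (y * β⁻¹) * r    ∎
        scaled i₁ = begin
          y                ≡⟨ *-identityʳ y ⟨
          y * 1#           ≡⟨ cong (y *_) (inv-l β β≢0) ⟨
          y * (β⁻¹ * β)    ≡⟨ *-assoc y β⁻¹ β ⟨
          (y * β⁻¹) * β    ∎
        scaled i₂ = sym (zeroʳ _)

  conicPlanePoint-cong : ∀ {a b c a′ b′ c′} u w → a ≡ a′ → b ≡ b′ → c ≡ c′ →
    conicPlanePoint a b c u w ≈ conicPlanePoint a′ b′ c′ u w
  conicPlanePoint-cong u w refl refl refl = ≈-refl {conicPlanePoint _ _ _ u w}

  outer-lin : ∀ x u y w → outer (lin x u y w) ≈ conicPlanePoint (x * x) (y * y) (x * y) u w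
  outer-lin x u y w i j = solve 6 (λ x y uᵢ uⱼ wᵢ wⱼ →
      (x :* uᵢ :+ y :* wᵢ) :* (x :* uⱼ :+ y :* wⱼ)
    := x :* x :* (uᵢ :* uⱼ) :+ (y :* y :* (wᵢ :* wⱼ) :+ x :* y :* (uᵢ :* wⱼ :+ wᵢ :* uⱼ)))
    refl x y (u i) (u j) (w i) (w j)

  pencil-coordinates : ∀ a′ b′ s t a b c u w →
    ((a′ ⊙ outer (lin s u t w)) ⊕ (b′ ⊙ conicPlanePoint a b c u w)) ≈
      conicPlanePoint (a′ * (s * s) + b′ * a) (a′ * (t * t) + b′ * b) (a′ * (s * t) + b′ * c) u w
  pencil-coordinates a′ b′ s t a b c u w i j = solve 11 (λ a′ b′ s t a b c uᵢ uⱼ wᵢ wⱼ →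
      a′ :* ((s :* uᵢ :+ t :* wᵢ) :* (s :* uⱼ :+ t :* wⱼ))
        :+ b′ :* (a :* (uᵢ :* uⱼ) :+ (b :* (wᵢ :* wⱼ) :+ c :* (uᵢ :* wⱼ :+ wᵢ :* uⱼ)))
    := (a′ :* (s :* s) :+ b′ :* a) :* (uᵢ :* uⱼ)
        :+ ((a′ :* (t :* t) :+ b′ :* b) :* (wᵢ :* wⱼ) :+ (a′ :* (s :* t) :+ b′ :* c) :* (uᵢ :* wⱼ :+ wᵢ :* uⱼ)))
    refl a′ b′ s t a b c (u i) (u j) (w i) (w j)

  minor-conicPlanePoint : ∀ a b c u w → minor2 (conicPlanePoint a b c u w) i₀ i₁ i₀ i₁ ≡
    (a * b + - (c * c)) * ((u i₀ * w i₁ + - (u i₁ * w i₀)) * (u i₀ * w i₁ + - (u i₁ * w i₀)))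
  minor-conicPlanePoint a b c u w = solve 7 (λ a b c u₀ u₁ w₀ w₁ →
      let m = λ (p q x y : Polynomial 7) → a :* (p :* q) :+ (b :* (x :* y) :+ c :* (p :* y :+ x :* q)) in
      m u₀ u₀ w₀ w₀ :* m u₁ u₁ w₁ w₁ :+ :- (m u₀ u₁ w₀ w₁ :* m u₁ u₀ w₁ w₀)
    := (a :* b :+ :- (c :* c)) :* ((u₀ :* w₁ :+ :- (u₁ :* w₀)) :* (u₀ :* w₁ :+ :- (u₁ :* w₀))))
    refl a b c (u i₀) (u i₁) (w i₀) (w i₁)

  private
    move : ∀ {x y z} → x ≡ y + z → z ≡ x + - y
    move {x} {y} {z} x≡y+z = trans (solve 2 (λ y z → z := y :+ z :+ :- y) refl y z) (cong (_+ - y) (sym x≡y+z))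

  module TangentDiscriminant {z : Mat} {u w : Vec3} (independent : LinIndep u w)
    {a b c : Carrier} (z≈abc : z ≈ conicPlanePoint a b c u w) {s t : Carrier} (v≢0 : ¬ IsZeroV (lin s u t w))
    (tangent : ∀ x y → ¬ IsZeroV (lin x u y w) →
       (Σ Carrier λ a′ → Σ Carrier λ b′ → outer (lin x u y w) ≈ ((a′ ⊙ outer (lin s u t w)) ⊕ (b′ ⊙ z))) →
       ProportionalV (lin x u y w) (lin s u t w)) where

    -- the discriminant of z, and the value Q at (s, t) of the adjoint
    -- quadratic form (b - c ; - c a)
    D Q : Carrier
    D = a * b + - (c * c)
    Q = b * (s * s) + - (c * (s * t)) + - (c * (s * t)) + a * (t * t)

    -- a conic point (x u + y w)(x u + y w)ᵀ ≠ v vᵀ on the line through v vᵀ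
    -- and z (given in coordinates) forces D = 0
    no-second-point : D ≢ 0# → ∀ x y a′ b′ → b′ ≢ 0# → x ≢ 0# ⊎ y ≢ 0# →
      x * x ≡ a′ * (s * s) + b′ * a → y * y ≡ a′ * (t * t) + b′ * b → x * y ≡ a′ * (s * t) + b′ * c → ⊥
    no-second-point D≢0 x y a′ b′ b′≢0 x,y≢0 xx≡ yy≡ xy≡ = *-nonzero (*-nonzero b′≢0 b′≢0) D≢0 b′²D≡0
      where
      on-line : outer (lin x u y w) ≈ ((a′ ⊙ outer (lin s u t w)) ⊕ (b′ ⊙ z))
      on-line = begin
        outer (lin x u y w)                                   ≈⟨ outer-lin x u y w ⟩
        conicPlanePoint (x * x) (y * y) (x * y) u w           ≈⟨ conicPlanePoint-cong u w xx≡ yy≡ xy≡ ⟩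
        conicPlanePoint (a′ * (s * s) + b′ * a) (a′ * (t * t) + b′ * b) (a′ * (s * t) + b′ * c) u w
                                                              ≈⟨ ≈-sym (pencil-coordinates a′ b′ s t a b c u w) ⟩
        (a′ ⊙ outer (lin s u t w)) ⊕ (b′ ⊙ conicPlanePoint a b c u w)
                                                              ≈⟨ (λ i j → cong (λ m → a′ * outer (lin s u t w) i j + b′ * m) (sym (z≈abc i j))) ⟩
        (a′ ⊙ outer (lin s u t w)) ⊕ (b′ ⊙ z)                 ∎
        where open import Relation.Binary.Reasoning.Setoid ≈-setoid

      p≢0 : ¬ IsZeroV (lin x u y w)
      p≢0 p≡0 = nonzero x,y≢0 (independent x y p≡0)
        where
        nonzero : x ≢ 0# ⊎ y ≢ 0# → x ≡ 0# × y ≡ 0# → ⊥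
        nonzero (inj₁ x≢0) (x≡0 , _) = x≢0 x≡0
        nonzero (inj₂ y≢0) (_ , y≡0) = y≢0 y≡0

      -- by tangency, (x, y) = l (s, t)
      p∝v : ProportionalV (lin x u y w) (lin s u t w)
      p∝v = tangent x y p≢0 (a′ , b′ , on-line)

      l : Carrier
      l = proj₁ p∝v

      x≡ls×y≡lt : x ≡ l * s × y ≡ l * t
      x≡ls×y≡lt = differences-zero (independent (x + - (l * s)) (y + - (l * t)) difference-zero)
        where
        differences-zero : x + - (l * s) ≡ 0# × y + - (l * t) ≡ 0# → x ≡ l * s × y ≡ l * t
        differences-zero (dx≡0 , dy≡0) = x∙y⁻¹≈ε⇒x≈y x (l * s) dx≡0 , x∙y⁻¹≈ε⇒x≈y y (l * t) dy≡0
        difference-zero : IsZeroV (lin (x + - (l * s)) u (y + - (l * t)) w)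
        difference-zero i = begin
          (x + - (l * s)) * u i + (y + - (l * t)) * w i     ≡⟨ solve 7 (λ x y l s t uᵢ wᵢ →
              (x :+ :- (l :* s)) :* uᵢ :+ (y :+ :- (l :* t)) :* wᵢ
            := (x :* uᵢ :+ y :* wᵢ) :+ :- (l :* (s :* uᵢ :+ t :* wᵢ))) refl x y l s t (u i) (w i) ⟩
          lin x u y w i + - (l * lin s u t w i)             ≡⟨ x≈y⇒x∙y⁻¹≈ε (proj₂ p∝v i) ⟩
          0#                                                ∎
          where open ≡-Reasoning

      b′²D≡0 : b′ * b′ * D ≡ 0#
      b′²D≡0 = begin
        b′ * b′ * D
          ≡⟨ solve 4 (λ b′ a b c → b′ :* b′ :* (a :* b :+ :- (c :* c)) := (b′ :* a) :* (b′ :* b) :+ :- ((b′ :* c) :* (b′ :* c))) refl b′ a b c ⟩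
        (b′ * a) * (b′ * b) + - ((b′ * c) * (b′ * c))
          ≡⟨ cong₃ (λ A B C → A * B + - (C * C)) (move xx≡) (move yy≡) (move xy≡) ⟩
        (x * x + - (a′ * (s * s))) * (y * y + - (a′ * (t * t))) + - ((x * y + - (a′ * (s * t))) * (x * y + - (a′ * (s * t))))
          ≡⟨ cong₂ (λ X Y → (X * X + - (a′ * (s * s))) * (Y * Y + - (a′ * (t * t))) + - ((X * Y + - (a′ * (s * t))) * (X * Y + - (a′ * (s * t)))))
                   (proj₁ x≡ls×y≡lt) (proj₂ x≡ls×y≡lt) ⟩
        (l * s * (l * s) + - (a′ * (s * s))) * (l * t * (l * t) + - (a′ * (t * t)))
          + - ((l * s * (l * t) + - (a′ * (s * t))) * (l * s * (l * t) + - (a′ * (s * t))))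
          ≡⟨ solve 4 (λ l s t a′ → (l :* s :* (l :* s) :+ :- (a′ :* (s :* s))) :* (l :* t :* (l :* t) :+ :- (a′ :* (t :* t)))
                :+ :- ((l :* s :* (l :* t) :+ :- (a′ :* (s :* t))) :* (l :* s :* (l :* t) :+ :- (a′ :* (s :* t)))) := 𝟎) refl l s t a′ ⟩
        0# ∎
        where open ≡-Reasoning

    -- If D ≠ 0 then Q = 0: otherwise the point λ v vᵀ + z, λ = - D / Q, of
    -- the tangent line has coordinates (M₀₀, M₁₁, M₀₁) of determinant
    -- λ Q + D = 0, so it is a second conic point on the tangent.
    Q≡0 : D ≢ 0# → Q ≢ 0# → ⊥
    Q≡0 D≢0 Q≢0 = second-point (M₀₀ ≟ 0#) (M₁₁ ≟ 0#)
      where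
      λ′ M₀₀ M₀₁ M₁₁ : Carrier
      λ′  = - D * inv Q Q≢0
      M₀₀ = λ′ * (s * s) + a
      M₀₁ = λ′ * (s * t) + c
      M₁₁ = λ′ * (t * t) + b

      singular : M₀₀ * M₁₁ ≡ M₀₁ * M₀₁
      singular = x∙y⁻¹≈ε⇒x≈y _ _ (begin
        M₀₀ * M₁₁ + - (M₀₁ * M₀₁)
          ≡⟨ solve 6 (λ l s t a b c → (l :* (s :* s) :+ a) :* (l :* (t :* t) :+ b) :+ :- ((l :* (s :* t) :+ c) :* (l :* (s :* t) :+ c))
                := l :* (b :* (s :* s) :+ :- (c :* (s :* t)) :+ :- (c :* (s :* t)) :+ a :* (t :* t)) :+ (a :* b :+ :- (c :* c))) refl λ′ s t a b c ⟩
        λ′ * Q + D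
          ≡⟨ cong (_+ D) (trans (*-assoc (- D) _ Q) (trans (cong (- D *_) (inv-l Q Q≢0)) (*-identityʳ (- D)))) ⟩
        - D + D
          ≡⟨ trans (+-comm (- D) D) (-‿inverseʳ D) ⟩
        0# ∎)
        where open ≡-Reasoning

      second-point : Dec (M₀₀ ≡ 0#) → Dec (M₁₁ ≡ 0#) → ⊥
      -- the conic point (M₀₀ u + M₀₁ w)(…)ᵀ is M₀₀ (λ′ v vᵀ + z)
      second-point (no M₀₀≢0) _ = no-second-point D≢0 M₀₀ M₀₁ (M₀₀ * λ′) M₀₀ M₀₀≢0 (inj₁ M₀₀≢0)
        (solve 3 (λ l s a → let m = l :* (s :* s) :+ a in m :* m := (m :* l) :* (s :* s) :+ m :* a) refl λ′ s a)
        (trans (sym singular) (solve 5 (λ l s t a b → let m = l :* (s :* s) :+ a in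
           m :* (l :* (t :* t) :+ b) := (m :* l) :* (t :* t) :+ m :* b) refl λ′ s t a b))
        (solve 5 (λ l s t a c → let m = l :* (s :* s) :+ a in
           m :* (l :* (s :* t) :+ c) := (m :* l) :* (s :* t) :+ m :* c) refl λ′ s t a c)
      -- the conic point (M₀₁ u + M₁₁ w)(…)ᵀ is M₁₁ (λ′ v vᵀ + z)
      second-point (yes _) (no M₁₁≢0) = no-second-point D≢0 M₀₁ M₁₁ (M₁₁ * λ′) M₁₁ M₁₁≢0 (inj₂ M₁₁≢0)
        (trans (sym singular) (solve 5 (λ l s t a b → let m = l :* (t :* t) :+ b in
           (l :* (s :* s) :+ a) :* m := (m :* l) :* (s :* s) :+ m :* a) refl λ′ s t a b))
        (solve 3 (λ l t b → let m = l :* (t :* t) :+ b in m :* m := (m :* l) :* (t :* t) :+ m :* b) refl λ′ t b)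
        (solve 5 (λ l s t b c → let m = l :* (t :* t) :+ b in
           (l :* (s :* t) :+ c) :* m := (m :* l) :* (s :* t) :+ m :* c) refl λ′ s t b c)
      -- if M vanishes, z = - λ′ v vᵀ has discriminant 0
      second-point (yes M₀₀≡0) (yes M₁₁≡0) = D≢0 (begin
        D
          ≡⟨ solve 6 (λ l s t a b c → a :* b :+ :- (c :* c)
                := (l :* (s :* s) :+ a :+ :- (l :* (s :* s))) :* (l :* (t :* t) :+ b :+ :- (l :* (t :* t)))
                  :+ :- ((l :* (s :* t) :+ c :+ :- (l :* (s :* t))) :* (l :* (s :* t) :+ c :+ :- (l :* (s :* t)))))
                refl λ′ s t a b c ⟩
        (M₀₀ + - (λ′ * (s * s))) * (M₁₁ + - (λ′ * (t * t))) + - ((M₀₁ + - (λ′ * (s * t))) * (M₀₁ + - (λ′ * (s * t))))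
          ≡⟨ cong₃ (λ m₀₀ m₀₁ m₁₁ → (m₀₀ + - (λ′ * (s * s))) * (m₁₁ + - (λ′ * (t * t)))
                                    + - ((m₀₁ + - (λ′ * (s * t))) * (m₀₁ + - (λ′ * (s * t))))) M₀₀≡0 M₀₁≡0 M₁₁≡0 ⟩
        (0# + - (λ′ * (s * s))) * (0# + - (λ′ * (t * t))) + - ((0# + - (λ′ * (s * t))) * (0# + - (λ′ * (s * t))))
          ≡⟨ solve 3 (λ l s t → (𝟎 :+ :- (l :* (s :* s))) :* (𝟎 :+ :- (l :* (t :* t)))
                :+ :- ((𝟎 :+ :- (l :* (s :* t))) :* (𝟎 :+ :- (l :* (s :* t)))) := 𝟎) refl λ′ s t ⟩
        0# ∎)
        where
        open ≡-Reasoning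
        M₀₁≡0 : M₀₁ ≡ 0#
        M₀₁≡0 = square-zero (trans (sym singular) (trans (cong (_* M₁₁) M₀₀≡0) (zeroˡ M₁₁)))

    -- - D is a square: either D = 0, or Q = 0 and then (b s - c t)² = - t² D
    negD-square : Σ Carrier λ σ → - D ≡ σ * σ
    negD-square = by-D (D ≟ 0#)
      where
      by-t : b ≢ 0# → Q ≡ 0# → Dec (t ≡ 0#) → Σ Carrier λ σ → - D ≡ σ * σ
      by-t b≢0 Q≡0 (yes t≡0) = ⊥-elim (v≢0 v≡0)
        where
        bss≡0 : b * (s * s) ≡ 0#
        bss≡0 = trans (sym (trans (cong (λ t → b * (s * s) + - (c * (s * t)) + - (c * (s * t)) + a * (t * t)) t≡0)
                                  (solve 4 (λ a b c s → b :* (s :* s) :+ :- (c :* (s :* 𝟎)) :+ :- (c :* (s :* 𝟎)) :+ a :* (𝟎 :* 𝟎)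
                                                        := b :* (s :* s)) refl a b c s)))
                      Q≡0
        s≡0 : s ≡ 0#
        s≡0 = square-zero (sym-zero (no-zero-divisors bss≡0))
          where
          sym-zero : b ≡ 0# ⊎ s * s ≡ 0# → s * s ≡ 0#
          sym-zero (inj₁ b≡0) = ⊥-elim (b≢0 b≡0)
          sym-zero (inj₂ ss≡0) = ss≡0
        v≡0 : IsZeroV (lin s u t w)
        v≡0 i = trans (cong₂ (λ s t → s * u i + t * w i) s≡0 t≡0)
                      (solve 2 (λ uᵢ wᵢ → 𝟎 :* uᵢ :+ 𝟎 :* wᵢ := 𝟎) refl (u i) (w i))
      by-t b≢0 Q≡0 (no t≢0) = X * t⁻¹ , sym (begin
        (X * t⁻¹) * (X * t⁻¹)              ≡⟨ solve 2 (λ X i → (X :* i) :* (X :* i) := (X :* X) :* (i :* i)) refl X t⁻¹ ⟩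
        (X * X) * (t⁻¹ * t⁻¹)              ≡⟨ cong (_* (t⁻¹ * t⁻¹)) X²≡-t²D ⟩
        - (t * t * D) * (t⁻¹ * t⁻¹)        ≡⟨ solve 3 (λ t D i → :- (t :* t :* D) :* (i :* i) := :- D :* ((t :* i) :* (t :* i))) refl t D t⁻¹ ⟩
        - D * ((t * t⁻¹) * (t * t⁻¹))      ≡⟨ cong (λ e → - D * (e * e)) (inv-r t t≢0) ⟩
        - D * (1# * 1#)                    ≡⟨ solve 1 (λ D → :- D :* (𝟏 :* 𝟏) := :- D) refl D ⟩
        - D                                ∎)
        where
        open ≡-Reasoning
        t⁻¹ X : Carrier
        t⁻¹ = inv t t≢0
        X   = b * s + - (c * t)
        X²≡-t²D : X * X ≡ - (t * t * D)
        X²≡-t²D = inverseˡ-unique (X * X) (t * t * D) (begin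
          X * X + t * t * D   ≡⟨ solve 5 (λ a b c s t → (b :* s :+ :- (c :* t)) :* (b :* s :+ :- (c :* t)) :+ t :* t :* (a :* b :+ :- (c :* c))
                                  := b :* (b :* (s :* s) :+ :- (c :* (s :* t)) :+ :- (c :* (s :* t)) :+ a :* (t :* t))) refl a b c s t ⟩
          b * Q               ≡⟨ cong (b *_) Q≡0 ⟩
          b * 0#              ≡⟨ zeroʳ b ⟩
          0#                  ∎)

      by-b : Q ≡ 0# → Dec (b ≡ 0#) → Σ Carrier λ σ → - D ≡ σ * σ
      by-b Q≡0 (yes b≡0) = c , trans (cong (λ b → - (a * b + - (c * c))) b≡0)
                                     (solve 2 (λ a c → :- (a :* 𝟎 :+ :- (c :* c)) := c :* c) refl a c)
      by-b Q≡0 (no b≢0)  = by-t b≢0 Q≡0 (t ≟ 0#)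

      by-Q : D ≢ 0# → Dec (Q ≡ 0#) → Σ Carrier λ σ → - D ≡ σ * σ
      by-Q D≢0 (yes Q≡0) = by-b Q≡0 (b ≟ 0#)
      by-Q D≢0 (no Q≢0)  = ⊥-elim (Q≡0 D≢0 Q≢0)

      by-D : Dec (D ≡ 0#) → Σ Carrier λ σ → - D ≡ σ * σ
      by-D (yes D≡0) = 0# , trans (cong -_ D≡0) (trans -0#≈0# (sym (zeroʳ 0#)))
      by-D (no D≢0)  = by-Q D≢0 (Q ≟ 0#)

  -- For an exterior point z, - minor₀₁(z) = - D d² is a square.
  exterior⇒negMinor-square : ∀ {z} → Exterior z → Σ Carrier λ ρ → - minor2 z i₀ i₁ i₀ i₁ ≡ ρ * ρ
  exterior⇒negMinor-square {z} (_ , u , w , independent , (a , b , c , z≈abc) , (s , t , v≢0 , tangent)) =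
    σ * d , (begin
      - minor2 z i₀ i₁ i₀ i₁                                     ≡⟨ cong -_ (minor-cong z≈abc i₀ i₁ i₀ i₁) ⟩
      - minor2 (conicPlanePoint a b c u w) i₀ i₁ i₀ i₁           ≡⟨ cong -_ (minor-conicPlanePoint a b c u w) ⟩
      - (D * (d * d))                                            ≡⟨ solve 2 (λ D d → :- (D :* (d :* d)) := :- D :* (d :* d)) refl D d ⟩
      - D * (d * d)                                              ≡⟨ cong (_* (d * d)) (proj₂ negD-square) ⟩
      (σ * σ) * (d * d)                                          ≡⟨ solve 2 (λ σ d → (σ :* σ) :* (d :* d) := (σ :* d) :* (σ :* d)) refl σ d ⟩
      (σ * d) * (σ * d)                                          ∎)
    where
    open ≡-Reasoning
    open TangentDiscriminant independent z≈abc v≢0 tangent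
    σ d : Carrier
    σ = proj₁ negD-square
    d = u i₀ * w i₁ + - (u i₁ * w i₀)

module Enumeration (F : FiniteField) where
  open import Data.Nat.Base as ℕ using (ℕ; suc)
  import Data.Nat.Properties as ℕ
  open import Data.List.Base using (List; []; _∷_; length; map; _++_; cartesianProduct)
  open import Data.List.Properties using (length-map; length-++)
  open import Data.List.Relation.Unary.All as All using (All; []; _∷_)
  import Data.List.Relation.Unary.All.Properties as AllP
  open import Data.List.Relation.Unary.Any using (Any; here; there)
  import Data.List.Relation.Unary.Any.Properties as AnyP
  open import Data.List.Relation.Unary.AllPairs as AllPairs using (AllPairs; []; _∷_)
  import Data.List.Relation.Unary.AllPairs.Properties as AllPairsP
  open import Data.List.Relation.Unary.Unique.Propositional using (Unique)
  import Data.List.Relation.Unary.Unique.Propositional.Properties as Unique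
  open import Data.List.Membership.Propositional using (_∈_; find; lose)
  open import Data.List.Membership.Propositional.Properties using (∈-filter⁺; ∈-filter⁻; ∈-cartesianProduct⁺; ∈-cartesianProduct⁻)
  open import Data.Product.Base using (Σ; _,_; proj₁; proj₂; _×_)
  open import Data.Sum.Base using (_⊎_; inj₁; inj₂; [_,_]′)
  open import Data.Empty using (⊥-elim)
  open import Relation.Nullary using (¬_; Dec; yes; no; ¬?)
  open import Relation.Binary.PropositionalEquality
  open FiniteField F
  open Geometry F renaming (sym to sym-product)
  open FieldFacts F
  open MatrixAlgebra F
  open Invariance F
  open StandardPlane F

  S-∼ : ∀ {α β γ α′ β′ γ′} c → c ≢ 0# → α ≡ c * α′ → β ≡ c * β′ → γ ≡ c * γ′ → S α β γ ∼ S α′ β′ γ′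
  S-∼ {α} {β} {γ} {α′} {β′} {γ′} c c≢0 α≡ β≡ γ≡ = c , c≢0 , entries
    where
    0≡c0 : 0# ≡ c * 0#
    0≡c0 = sym (zeroʳ c)
    entries : ∀ i j → S α β γ i j ≡ c * S α′ β′ γ′ i j
    entries i₀ i₀ = α≡
    entries i₀ i₁ = 0≡c0
    entries i₀ i₂ = γ≡
    entries i₁ i₀ = 0≡c0
    entries i₁ i₁ = β≡
    entries i₁ i₂ = 0≡c0
    entries i₂ i₀ = γ≡
    entries i₂ i₁ = 0≡c0
    entries i₂ i₂ = 0≡c0

  S-∼-normalise : ∀ {α β γ} c (c≢0 : c ≢ 0#) {α′ β′ γ′} → α′ ≡ α * inv c c≢0 → β′ ≡ β * inv c c≢0 →
    γ′ ≡ γ * inv c c≢0 → S α β γ ∼ S α′ β′ γ′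
  S-∼-normalise {α} {β} {γ} c c≢0 refl refl refl =
    S-∼ c c≢0 (*-inv-cancel α c c≢0) (*-inv-cancel β c c≢0) (*-inv-cancel γ c c≢0)

  private
    unit-scale : ∀ {c a a′} → 1# ≡ c * 1# → a ≡ c * a′ → a ≡ a′
    unit-scale {c} {a} {a′} 1≡c1 a≡ca′ =
      trans a≡ca′ (trans (cong (_* a′) (trans (sym (*-identityʳ c)) (sym 1≡c1))) (*-identityˡ a′))

    not-zero-scale : ∀ {c} → 1# ≢ c * 0#
    not-zero-scale {c} 1≡c0 = 1≢0 (trans 1≡c0 (zeroʳ c))

  S-α01-injective : ∀ {α α′} → S α 0# 1# ∼ S α′ 0# 1# → α ≡ α′
  S-α01-injective (_ , _ , entries) = unit-scale (entries i₂ i₀) (entries i₀ i₀)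

  S-α10-injective : ∀ {α α′} → S α 1# 0# ∼ S α′ 1# 0# → α ≡ α′
  S-α10-injective (_ , _ , entries) = unit-scale (entries i₁ i₁) (entries i₀ i₀)

  S-αβ1-injective : ∀ {α β α′ β′} → S α β 1# ∼ S α′ β′ 1# → (α , β) ≡ (α′ , β′)
  S-αβ1-injective (_ , _ , entries) =
    cong₂ _,_ (unit-scale (entries i₂ i₀) (entries i₀ i₀)) (unit-scale (entries i₂ i₀) (entries i₁ i₁))

  S-α01≁S-α10 : ∀ {α α′} → ¬ (S α 0# 1# ∼ S α′ 1# 0#)
  S-α01≁S-α10 (_ , _ , entries) = not-zero-scale (entries i₂ i₀)

  S₁₀₀≁S₀₁₀ : ¬ (S 1# 0# 0# ∼ S 0# 1# 0#)
  S₁₀₀≁S₀₁₀ (_ , _ , entries) = not-zero-scale (entries i₀ i₀)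

  rank<3 : ∀ {α β γ} → det (S α β γ) ≡ 0# → β ≡ 0# ⊎ γ ≡ 0#
  rank<3 {α} {β} {γ} det≡0 with no-zero-divisors (neg-zero (trans (sym (det-S α β γ)) det≡0))
  ... | inj₁ β≡0  = inj₁ β≡0
  ... | inj₂ γγ≡0 = inj₂ (square-zero γγ≡0)

  rank3-coordinates : ∀ {α β γ} → det (S α β γ) ≢ 0# → β ≢ 0# × γ ≢ 0#
  rank3-coordinates {α} {β} {γ} det≢0 =
    (λ β≡0 → det≢0 (trans (det-S α β γ) (trans (cong (λ β → - (β * (γ * γ))) β≡0)
                     (solve 1 (λ γ → :- (𝟎 :* (γ :* γ)) := 𝟎) refl γ)))) ,
    (λ γ≡0 → det≢0 (trans (det-S α β γ) (trans (cong (λ γ → - (β * (γ * γ))) γ≡0)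
                     (solve 1 (λ β → :- (β :* (𝟎 :* 𝟎)) := 𝟎) refl β))))

  rank≥2-coordinates : ∀ {α β} → ¬ MinorsVanish (S α β 0#) → α ≢ 0# × β ≢ 0#
  rank≥2-coordinates {α} {β} minors≢0 =
    (λ α≡0 → minors≢0 (λ i j k l → trans (minor-cong (S-on-conic₀₁ α β) i j k l)
                        (subst (λ α → MinorsVanish (conicPlanePoint α β 0# e₀ e₁)) (sym α≡0)
                               (minorsVanish-conicPoint₂ β e₀ e₁) i j k l))) ,
    (λ β≡0 → minors≢0 (λ i j k l → trans (minor-cong (S-on-conic₀₁ α β) i j k l)
                        (subst (λ β → MinorsVanish (conicPlanePoint α β 0# e₀ e₁)) (sym β≡0)
                               (minorsVanish-conicPoint₁ α e₀ e₁) i j k l)))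

  negSquare⁺ : ∀ {c ρ} → c ≢ 0# → - c ≡ ρ * ρ → NegSquare c
  negSquare⁺ {c} {ρ} c≢0 -c≡ρ² = lose (∈-nonzeros⁺ ρ≢0) (trans (cong -_ (sym -c≡ρ²)) (-‿involutive c))
    where
    ρ≢0 : ρ ≢ 0#
    ρ≢0 ρ≡0 = c≢0 (neg-zero (trans -c≡ρ² (trans (cong (λ x → x * x) ρ≡0) (zeroʳ 0#))))

  negSquare⁻ : ∀ {c} → NegSquare c → Σ Carrier λ r → - c ≡ r * r
  negSquare⁻ {c} negSq = witness (find negSq)
    where
    witness : Σ Carrier (λ r → r ∈ nonzeros × - (r * r) ≡ c) → Σ Carrier λ r → - c ≡ r * r
    witness (r , _ , -r²≡c) = r , trans (cong -_ (sym -r²≡c)) (-‿involutive (r * r))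

  square-ratio : ∀ {α β ρ} (β≢0 : β ≢ 0#) → - (α * β) ≡ ρ * ρ →
    - (α * inv β β≢0) ≡ (ρ * inv β β≢0) * (ρ * inv β β≢0)
  square-ratio {α} {β} {ρ} β≢0 -αβ≡ρ² = begin
    - (α * β⁻¹)                   ≡⟨ cong (λ x → - (x * β⁻¹)) (*-identityʳ α) ⟨
    - (α * 1# * β⁻¹)              ≡⟨ cong (λ x → - (α * x * β⁻¹)) (inv-l β β≢0) ⟨
    - (α * (β⁻¹ * β) * β⁻¹)       ≡⟨ solve 3 (λ α β i → :- (α :* (i :* β) :* i) := :- (α :* β) :* (i :* i)) refl α β β⁻¹ ⟩
    - (α * β) * (β⁻¹ * β⁻¹)       ≡⟨ cong (_* (β⁻¹ * β⁻¹)) -αβ≡ρ² ⟩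
    (ρ * ρ) * (β⁻¹ * β⁻¹)         ≡⟨ solve 2 (λ ρ i → (ρ :* ρ) :* (i :* i) := (ρ :* i) :* (ρ :* i)) refl ρ β⁻¹ ⟩
    (ρ * β⁻¹) * (ρ * β⁻¹)         ∎
    where
    open ≡-Reasoning
    β⁻¹ : Carrier
    β⁻¹ = inv β β≢0

  square-ratio⁻ : ∀ {α β r} (β≢0 : β ≢ 0#) → - (α * inv β β≢0) ≡ r * r → - (α * β) ≡ (r * β) * (r * β)
  square-ratio⁻ {α} {β} {r} β≢0 -α/β≡r² = begin
    - (α * β)                   ≡⟨ cong (λ x → - (x * β)) (*-inv-cancel α β β≢0) ⟩
    - (β * (α * β⁻¹) * β)       ≡⟨ solve 2 (λ β x → :- (β :* x :* β) := :- x :* (β :* β)) refl β (α * β⁻¹) ⟩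
    - (α * β⁻¹) * (β * β)       ≡⟨ cong (_* (β * β)) -α/β≡r² ⟩
    (r * r) * (β * β)           ≡⟨ solve 2 (λ r β → (r :* r) :* (β :* β) := (r :* β) :* (r :* β)) refl r β ⟩
    (r * β) * (r * β)           ∎
    where
    open ≡-Reasoning
    β⁻¹ : Carrier
    β⁻¹ = inv β β≢0

  private
    ∼-map-member : ∀ {A : Set} {X} (f : A → Mat) {x xs} → x ∈ xs → X ∼ f x → Any (X ∼_) (map f xs)
    ∼-map-member f x∈xs X∼fx = AnyP.map⁺ (lose x∈xs X∼fx)

    distinct-map : ∀ {A : Set} (f : A → Mat) → (∀ {x y} → f x ∼ f y → x ≡ y) →
                   ∀ {xs} → Unique xs → AllPairs (λ X Y → ¬ (X ∼ Y)) (map f xs)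
    distinct-map f f-injective unique = AllPairsP.map⁺ (AllPairs.map (λ x≢y fx∼fy → x≢y (f-injective fx∼fy)) unique)

  S-α01 S-α10 : Carrier → Mat
  S-α01 α = S α 0# 1#
  S-α10 α = S α 1# 0#

  S-αβ1 : Carrier × Carrier → Mat
  S-αβ1 (α , β) = S α β 1#

  rank1Points : List Mat
  rank1Points = S 1# 0# 0# ∷ S 0# 1# 0# ∷ []

  enumerates-rank1 : Enumerates Rank1 rank1Points
  enumerates-rank1 =
    ((1# , 0# , 0# , ≈-refl {S 1# 0# 0#}) , proj₁ rank1-S₁₀₀ , rank1-S₁₀₀) ∷
    ((0# , 1# , 0# , ≈-refl {S 0# 1# 0#}) , proj₁ rank1-S₀₁₀ , rank1-S₀₁₀) ∷ [] ,
    (S₁₀₀≁S₀₁₀ ∷ []) ∷ [] ∷ [] ,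
    complete
    where
    complete : ∀ α β γ → ¬ IsZero (S α β γ) → Rank1 (S α β γ) → Any (S α β γ ∼_) rank1Points
    complete α β γ S≢0 (_ , minors) = by-α (α ≟ 0#)
      where
      γ≡0 : γ ≡ 0#
      γ≡0 = square-zero (neg-zero (trans (sym (minor-S₀₂ α β γ)) (minors i₀ i₂ i₀ i₂)))
      αβ≡0 : α * β ≡ 0#
      αβ≡0 = trans (sym (minor-S₀₁ α β γ)) (minors i₀ i₁ i₀ i₁)
      0≡x0 : ∀ x → 0# ≡ x * 0#
      0≡x0 x = sym (zeroʳ x)
      by-α : Dec (α ≡ 0#) → Any (S α β γ ∼_) rank1Points
      by-α (yes α≡0) = there (here (S-∼ β β≢0 (trans α≡0 (0≡x0 β)) (sym (*-identityʳ β)) (trans γ≡0 (0≡x0 β))))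
        where
        β≢0 : β ≢ 0#
        β≢0 β≡0 = S≢0 (λ { i₀ i₀ → α≡0 ; i₀ i₁ → refl ; i₀ i₂ → γ≡0 ; i₁ i₀ → refl ; i₁ i₁ → β≡0 ; i₁ i₂ → refl
                         ; i₂ i₀ → γ≡0 ; i₂ i₁ → refl ; i₂ i₂ → refl })
      by-α (no α≢0) = here (S-∼ α α≢0 (sym (*-identityʳ α)) (trans β≡0 (0≡x0 α)) (trans γ≡0 (0≡x0 α)))
        where
        β≡0 : β ≡ 0#
        β≡0 = [ (λ α≡0 → ⊥-elim (α≢0 α≡0)) , (λ β≡0 → β≡0) ]′ (no-zero-divisors αβ≡0)

  S≢0-γ : ∀ {α β γ} → γ ≢ 0# → ¬ IsZero (S α β γ)
  S≢0-γ γ≢0 S≡0 = γ≢0 (S≡0 i₂ i₀)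

  S≢0-β : ∀ {α β γ} → β ≢ 0# → ¬ IsZero (S α β γ)
  S≢0-β β≢0 S≡0 = β≢0 (S≡0 i₁ i₁)

  private
    0≡0/c : ∀ {x} c (c≢0 : c ≢ 0#) → x ≡ 0# → 0# ≡ x * inv c c≢0
    0≡0/c c c≢0 x≡0 = sym (trans (cong (_* inv c c≢0) x≡0) (zeroˡ _))

    1≡c/c : ∀ c (c≢0 : c ≢ 0#) → 1# ≡ c * inv c c≢0
    1≡c/c c c≢0 = sym (inv-r c c≢0)

  exteriorPoints : List Mat
  exteriorPoints = map S-α01 elements ++ map S-α10 negSquares

  enumerates-exterior : Enumerates Exterior exteriorPoints
  enumerates-exterior =
    AllP.++⁺ (AllP.map⁺ (All.tabulate (λ {α} _ → α01-exterior α))) (AllP.map⁺ (All.tabulate α10-exterior)) ,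
    AllPairsP.++⁺ (distinct-map S-α01 S-α01-injective elements-unique)
                  (distinct-map S-α10 S-α10-injective negSquares-unique)
                  (AllP.map⁺ (All.tabulate (λ _ → AllP.map⁺ (All.tabulate (λ _ → S-α01≁S-α10))))) ,
    complete
    where
    α01-exterior : ∀ α → InStandardPlane (S-α01 α) × ¬ IsZero (S-α01 α) × Exterior (S-α01 α)
    α01-exterior α = (α , 0# , 1# , ≈-refl {S-α01 α}) , S≢0-γ 1≢0 , exterior-S-α0γ α 1# 1≢0

    α10-exterior : ∀ {α} → α ∈ negSquares → InStandardPlane (S-α10 α) × ¬ IsZero (S-α10 α) × Exterior (S-α10 α)
    α10-exterior {α} α∈ = (α , 1# , 0# , ≈-refl {S-α10 α}) , S≢0-β 1≢0 ,
      exterior-S-αβ0 α 1# r (∈-nonzeros⁻ (proj₁ α∈′)) 1≢0 (trans (cong -_ (*-identityʳ α)) (proj₂ r-square))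
      where
      α∈′ : α ∈ nonzeros × NegSquare α
      α∈′ = ∈-filter⁻ negSquare? {xs = nonzeros} α∈
      r-square : Σ Carrier λ r → - α ≡ r * r
      r-square = negSquare⁻ (proj₂ α∈′)
      r : Carrier
      r = proj₁ r-square

    complete : ∀ α β γ → ¬ IsZero (S α β γ) → Exterior (S α β γ) → Any (S α β γ ∼_) exteriorPoints
    complete α β γ S≢0 ext = by-γ (γ ≟ 0#)
      where
      by-γ : Dec (γ ≡ 0#) → Any (S α β γ ∼_) exteriorPoints
      -- γ ≠ 0: the rank is 2, so β = 0
      by-γ (no γ≢0) = AnyP.++⁺ˡ (∼-map-member S-α01 (elements-complete (α * inv γ γ≢0))
                        (S-∼-normalise γ γ≢0 refl (0≡0/c γ γ≢0 β≡0) (1≡c/c γ γ≢0)))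
        where
        β≡0 : β ≡ 0#
        β≡0 = [ (λ β≡0 → β≡0) , (λ γ≡0 → ⊥-elim (γ≢0 γ≡0)) ]′ (rank<3 (proj₂ (proj₁ ext)))
      -- γ = 0: α, β ≠ 0 and - α β is a square
      by-γ (yes γ≡0) = AnyP.++⁺ʳ (map S-α01 elements) (∼-map-member S-α10 α/β∈
                         (S-∼-normalise β β≢0 refl (1≡c/c β β≢0) (0≡0/c β β≢0 γ≡0)))
        where
        α≢0×β≢0 : α ≢ 0# × β ≢ 0#
        α≢0×β≢0 = rank≥2-coordinates (subst (λ γ → ¬ MinorsVanish (S α β γ)) γ≡0 (proj₁ (proj₁ ext)))
        β≢0 : β ≢ 0#
        β≢0 = proj₂ α≢0×β≢0
        ρ-square : Σ Carrier λ ρ → - minor2 (S α β γ) i₀ i₁ i₀ i₁ ≡ ρ * ρ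
        ρ-square = exterior⇒negMinor-square ext
        -αβ≡ρ² : - (α * β) ≡ proj₁ ρ-square * proj₁ ρ-square
        -αβ≡ρ² = trans (cong -_ (sym (minor-S₀₁ α β γ))) (proj₂ ρ-square)
        α/β∈ : α * inv β β≢0 ∈ negSquares
        α/β∈ = ∈-filter⁺ negSquare? (∈-nonzeros⁺ α/β≢0) (negSquare⁺ α/β≢0 (square-ratio β≢0 -αβ≡ρ²))
          where
          α/β≢0 : α * inv β β≢0 ≢ 0#
          α/β≢0 = *-nonzero (proj₁ α≢0×β≢0) (inv-nonzero β β≢0)

  interiorPoints : List Mat
  interiorPoints = map S-α10 nonNegSquares

  enumerates-interior : Enumerates Interior interiorPoints
  enumerates-interior =
    AllP.map⁺ (All.tabulate α10-interior) , distinct-map S-α10 S-α10-injective nonNegSquares-unique , complete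
    where
    α10-interior : ∀ {α} → α ∈ nonNegSquares → InStandardPlane (S-α10 α) × ¬ IsZero (S-α10 α) × Interior (S-α10 α)
    α10-interior {α} α∈ = (α , 1# , 0# , ≈-refl {S-α10 α}) , S≢0-β 1≢0 , ((minors≢0 , det≡0) , ¬exterior)
      where
      α∈′ : α ∈ nonzeros × ¬ NegSquare α
      α∈′ = ∈-filter⁻ (λ c → ¬? (negSquare? c)) {xs = nonzeros} α∈
      α≢0 : α ≢ 0#
      α≢0 = ∈-nonzeros⁻ (proj₁ α∈′)
      minors≢0 : ¬ MinorsVanish (S α 1# 0#)
      minors≢0 vanish = α≢0 (trans (sym (*-identityʳ α)) (trans (sym (minor-S₀₁ α 1# 0#)) (vanish i₀ i₁ i₀ i₁)))
      det≡0 : det (S α 1# 0#) ≡ 0#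
      det≡0 = trans (det-S α 1# 0#) (solve 0 (:- (𝟏 :* (𝟎 :* 𝟎)) := 𝟎) refl)
      ¬exterior : ¬ Exterior (S α 1# 0#)
      ¬exterior ext = proj₂ α∈′ (negSquare⁺ α≢0 (trans (cong -_ (trans (sym (*-identityʳ α)) (sym (minor-S₀₁ α 1# 0#))))
                                                       (proj₂ (exterior⇒negMinor-square ext))))

    complete : ∀ α β γ → ¬ IsZero (S α β γ) → Interior (S α β γ) → Any (S α β γ ∼_) interiorPoints
    complete α β γ S≢0 ((minors≢0 , det≡0) , ¬ext) = by-γ (γ ≟ 0#)
      where
      by-γ : Dec (γ ≡ 0#) → Any (S α β γ ∼_) interiorPoints
      -- γ ≠ 0 forces β = 0, and then S α 0 γ is exterior
      by-γ (no γ≢0) = ⊥-elim (¬ext (subst (λ β → Exterior (S α β γ)) (sym β≡0) (exterior-S-α0γ α γ γ≢0)))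
        where
        β≡0 : β ≡ 0#
        β≡0 = [ (λ β≡0 → β≡0) , (λ γ≡0 → ⊥-elim (γ≢0 γ≡0)) ]′ (rank<3 det≡0)
      -- γ = 0: α / β is not of the form - r², otherwise S α β 0 would be exterior
      by-γ (yes γ≡0) = ∼-map-member S-α10 α/β∈ (S-∼-normalise β β≢0 refl (1≡c/c β β≢0) (0≡0/c β β≢0 γ≡0))
        where
        α≢0×β≢0 : α ≢ 0# × β ≢ 0#
        α≢0×β≢0 = rank≥2-coordinates (subst (λ γ → ¬ MinorsVanish (S α β γ)) γ≡0 minors≢0)
        β≢0 : β ≢ 0#
        β≢0 = proj₂ α≢0×β≢0
        ¬negSquare : ¬ NegSquare (α * inv β β≢0)
        ¬negSquare negSq = ¬ext (subst (λ γ → Exterior (S α β γ)) (sym γ≡0)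
          (exterior-S-αβ0 α β (proj₁ (negSquare⁻ negSq) * β) (proj₁ α≢0×β≢0) β≢0
                          (square-ratio⁻ β≢0 (proj₂ (negSquare⁻ negSq)))))
        α/β∈ : α * inv β β≢0 ∈ nonNegSquares
        α/β∈ = ∈-filter⁺ (λ c → ¬? (negSquare? c)) (∈-nonzeros⁺ (*-nonzero (proj₁ α≢0×β≢0) (inv-nonzero β β≢0))) ¬negSquare

  rank3Points : List Mat
  rank3Points = map S-αβ1 (cartesianProduct elements nonzeros)

  enumerates-rank3 : Enumerates Rank3 rank3Points
  enumerates-rank3 =
    AllP.map⁺ (All.tabulate αβ1-rank3) ,
    distinct-map S-αβ1 S-αβ1-injective (Unique.cartesianProduct⁺ elements-unique nonzeros-unique) ,
    complete
    where
    αβ1-rank3 : ∀ {αβ} → αβ ∈ cartesianProduct elements nonzeros →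
                InStandardPlane (S-αβ1 αβ) × ¬ IsZero (S-αβ1 αβ) × Rank3 (S-αβ1 αβ)
    αβ1-rank3 {α , β} αβ∈ = (α , β , 1# , ≈-refl {S α β 1#}) , S≢0-γ 1≢0 ,
      (λ det≡0 → ∈-nonzeros⁻ (proj₂ (∈-cartesianProduct⁻ elements nonzeros αβ∈))
                   (neg-zero (trans (sym (trans (det-S α β 1#) (cong -_ (trans (cong (β *_) (*-identityʳ 1#)) (*-identityʳ β)))))
                                    det≡0)))

    complete : ∀ α β γ → ¬ IsZero (S α β γ) → Rank3 (S α β γ) → Any (S α β γ ∼_) rank3Points
    complete α β γ S≢0 det≢0 = ∼-map-member S-αβ1
      (∈-cartesianProduct⁺ (elements-complete (α * inv γ γ≢0)) (∈-nonzeros⁺ (*-nonzero β≢0 (inv-nonzero γ γ≢0))))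
      (S-∼-normalise γ γ≢0 refl refl (1≡c/c γ γ≢0))
      where
      β≢0 : β ≢ 0#
      β≢0 = proj₁ (rank3-coordinates det≢0)
      γ≢0 : γ ≢ 0#
      γ≢0 = proj₂ (rank3-coordinates det≢0)

  module Lengths (k : ℕ) (order≡ : order ≡ suc (2 ℕ.* k)) where
    open OddOrder k order≡

    length-exteriorPoints : length exteriorPoints ≡ 3 ℕ.* k ℕ.+ 1
    length-exteriorPoints = begin
      length (map S-α01 elements ++ map S-α10 negSquares)          ≡⟨ length-++ (map S-α01 elements) ⟩
      length (map S-α01 elements) ℕ.+ length (map S-α10 negSquares) ≡⟨ cong₂ ℕ._+_ (length-map S-α01 elements) (length-map S-α10 negSquares) ⟩
      order ℕ.+ length negSquares                                   ≡⟨ cong₂ ℕ._+_ order≡ length-negSquares ⟩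
      suc (2 ℕ.* k) ℕ.+ k                                           ≡⟨ ℕ.+-comm (suc (2 ℕ.* k)) k ⟩
      k ℕ.+ suc (2 ℕ.* k)                                           ≡⟨ ℕ.+-suc k (2 ℕ.* k) ⟩
      suc (3 ℕ.* k)                                                 ≡⟨ ℕ.+-comm 1 (3 ℕ.* k) ⟩
      3 ℕ.* k ℕ.+ 1                                                 ∎
      where open ≡-Reasoning

    length-interiorPoints : length interiorPoints ≡ k
    length-interiorPoints = trans (length-map S-α10 nonNegSquares) length-nonNegSquares

    length-rank3Points : length rank3Points ≡ order ℕ.* order ℕ.∸ order
    length-rank3Points = begin
      length (map S-αβ1 (cartesianProduct elements nonzeros))   ≡⟨ length-map S-αβ1 (cartesianProduct elements nonzeros) ⟩
      length (cartesianProduct elements nonzeros)               ≡⟨ length-cartesianProduct elements nonzeros ⟩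
      order ℕ.* length nonzeros                                 ≡⟨ q[q-1] order-nonzeros ⟩
      order ℕ.* order ℕ.∸ order                                 ∎
      where
      open ≡-Reasoning
      length-cartesianProduct : ∀ {X Y : Set} (xs : List X) (ys : List Y) →
        length (cartesianProduct xs ys) ≡ length xs ℕ.* length ys
      length-cartesianProduct [] ys = refl
      length-cartesianProduct (x ∷ xs) ys = trans (length-++ (map (x ,_) ys))
        (cong₂ ℕ._+_ (length-map (x ,_) ys) (length-cartesianProduct xs ys))
      q[q-1] : ∀ {q n} → q ≡ suc n → q ℕ.* n ≡ q ℕ.* q ℕ.∸ q
      q[q-1] {n = n} refl = trans (ℕ.*-distribˡ-∸ (suc n) (suc n) 1) (cong (suc n ℕ.* suc n ℕ.∸_) (ℕ.*-identityʳ (suc n)))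

open import Data.Nat using (ℕ; suc; _+_; _*_; _∸_)
open import Data.Product using (_×_; _,_)
open import Relation.Binary.PropositionalEquality using (_≡_; refl)

lemma6p1 : (F : FiniteField) (k : ℕ) → FiniteField.order F ≡ suc (2 * k) →
    (A : Geometry.Mat F) → Geometry.Invertible F A →
      let q = FiniteField.order F in
      Geometry.NumPoints F A (Geometry.Rank1 F) 2 ×
      Geometry.NumPoints F A (Geometry.Exterior F) (3 * k + 1) ×
      Geometry.NumPoints F A (Geometry.Interior F) k ×
      Geometry.NumPoints F A (Geometry.Rank3 F) (q * q ∸ q)
lemma6p1 F k order≡ A (B , AB≈I , BA≈I) =
  numPoints-transfer Rank1 rank1-act rank1-reflect rank1-cong refl enumerates-rank1 ,
  numPoints-transfer Exterior exterior-act exterior-reflect exterior-cong length-exteriorPoints enumerates-exterior ,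
  numPoints-transfer Interior interior-act interior-reflect interior-cong length-interiorPoints enumerates-interior ,
  numPoints-transfer Rank3 rank3-act rank3-reflect rank3-cong length-rank3Points enumerates-rank3
  where
  open Geometry F
  open Invariance F
  open Invertible {A} {B} BA≈I AB≈I
  open Enumeration F
  open Lengths k order≡
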